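{- Let $r\ge1$ and let $x_1,\dots,x_r,y$ be indeterminates; work in $\mathbb{Z}[x_1,\dots,x_r,y]$. Define $\boldsymbol{\alpha}=(\alpha_i)_{i\ge0}$ by $\alpha_0=\dots=\alpha_{r-1}=0$ and, for $i\ge r$, $\alpha_i=y$ if $i\equiv r\pmod{r+1}$ and $\alpha_i=\lfloor i/(r+1)\rfloor x_{j+1}$ if $i\equiv j\pmod{r+1}$ with $0\le j\le r-1$. Set $g_{k,n}=0$ for $n<0$ (all $k$), $g_{k,n}=\delta_{n0}$ for $k<0$, $n \ge 0$, and define $g_{k,n}$ for $k,n\ge0$ recursively by $$g_{k,n}=\Big(\tilde{\mathcal D}_r+\sum_{i=1}^r\alpha_{k+i}\Big)g_{k,n-1}+g_{k-r,n},$$ where $\tilde{\mathcal D}_r=\sum_{i=1}^r\Big(x_i\sum_{1\le j\le r,\,j\ne i}x_j\Big)\frac{\partial}{\partial x_i}+\big(\sum_{i=1}^rx_i\big)y\frac{\partial}{\partial y}$ and $\alpha_{k+i}$ acts by multiplication. Then: (a) $g_{k,0}=1$ for all $k\in\mathbb Z$. (b) $g_{k,n}-g_{k-1,n}=\alpha_{k+r}\,g_{k+r,n-1}$ for all $k\ge-r$ and $n\ge0$. (c) $S^{(r)}_n((\alpha_i)_{i\ge r})=g_{0,n}=(\tilde{\mathcal D}_r+y)^n\,1$ for all $n\ge0$.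
   Context: $m$-Stieltjes–Rogers polynomials: for an integer $m\ge1$, an $m$-Dyck path of length $(m+1)n$ is a path in $\mathbb{Z}\times\mathbb{N}$ from $(0,0)$ to $((m+1)n,0)$ with steps $(1,1)$ (rises) and $(1,-m)$ ($m$-falls). For $\boldsymbol\alpha=(\alpha_i)_{i\ge m}$, $S^{(m)}_n(\boldsymbol\alpha)$ is the sum over all such paths of the product of the weights, where each rise has weight $1$ and each $m$-fall starting at height $i$ has weight $\alpha_i$. In $(\tilde{\mathcal D}_r+y)^n 1$, $y$ acts by multiplication. -}

module Defs where

open import Data.Nat as ℕ using (ℕ; zero; suc; _<?_; _≡ᵇ_; _≤ᵇ_; _∸_; pred)
open import Data.Nat.DivMod using (_/_; _%_)
open import Data.Integer as ℤ using (ℤ; +_; -[1+_]; ∣_∣; _-_)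
open import Data.Fin as Fin using (Fin; toℕ; fromℕ<)
open import Data.Bool using (Bool; true; false; if_then_else_; _∧_)
open import Data.List using (List; []; _∷_; map; _++_)
open import Relation.Nullary using (yes; no; does)
open import Relation.Binary.PropositionalEquality using (_≡_)

-- Polynomials in ℤ[x₁,…,x_r,y], represented by their coefficient functions:
-- p a b is the coefficient of the monomial x^a y^b (a : Fin r → ℕ).
Mon : ℕ → Set
Mon r = Fin r → ℕ

Poly : ℕ → Set
Poly r = Mon r → ℕ → ℤ

infix 4 _≈P_
_≈P_ : ∀ {r} → Poly r → Poly r → Set
p ≈P q = ∀ a b → p a b ≡ q a b

allZero : ∀ r → Mon r → Bool
allZero zero a = true
allZero (suc r) a = (a Fin.zero ≡ᵇ 0) ∧ allZero r (λ j → a (Fin.suc j))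

0P : ∀ {r} → Poly r
0P a b = + 0

1P : ∀ {r} → Poly r
1P {r} a zero = if allZero r a then + 1 else + 0
1P a (suc b) = + 0

infixl 6 _+P_
_+P_ : ∀ {r} → Poly r → Poly r → Poly r
(p +P q) a b = p a b ℤ.+ q a b

scale : ∀ {r} → ℤ → Poly r → Poly r
scale c p a b = c ℤ.* p a b

upd : ∀ {r} → Mon r → Fin r → (ℕ → ℕ) → Mon r
upd a i f j = if does (i Fin.≟ j) then f (a j) else a j

killIfZero : ℕ → ℤ → ℤ
killIfZero zero z = + 0
killIfZero (suc _) z = z

mulX : ∀ {r} → Fin r → Poly r → Poly r
mulX i p a b = killIfZero (a i) (p (upd a i pred) b)

mulY : ∀ {r} → Poly r → Poly r
mulY p a zero = + 0
mulY p a (suc b) = p a b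

dX : ∀ {r} → Fin r → Poly r → Poly r
dX i p a b = + suc (a i) ℤ.* p (upd a i suc) b

dY : ∀ {r} → Poly r → Poly r
dY p a b = + suc b ℤ.* p a (suc b)

sumFin : ∀ {r} n → (Fin n → Poly r) → Poly r
sumFin zero f = 0P
sumFin (suc n) f = f Fin.zero +P sumFin n (λ i → f (Fin.suc i))

Dtilde : ∀ r → Poly r → Poly r
Dtilde r p =
  sumFin r (λ i → sumFin r (λ j → if does (i Fin.≟ j) then 0P else mulX i (mulX j (dX i p))))
  +P sumFin r (λ i → mulX i (mulY (dY p)))

-- multiplication by α_i (indices from 0):
--   α_i = 0 for i < r; for i ≥ r, α_i = y if i ≡ r mod (r+1),
--   α_i = ⌊i/(r+1)⌋ x_{j+1} if i ≡ j mod (r+1), 0 ≤ j ≤ r-1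
-- (Fin r index j corresponds to the variable x_{j+1}).
αact : ∀ r → ℕ → Poly r → Poly r
αact r i p with i <? r
... | yes _ = 0P
... | no _ with i % suc r <? r
...   | yes j<r = scale (+ (i / suc r)) (mulX (fromℕ< j<r) p)
...   | no _ = mulY p

α : ∀ r → ℕ → Poly r
α r i = αact r i 1P

sumα : ∀ r → ℕ → Poly r → Poly r
sumα r k p = sumFin r (λ i → αact r (k ℕ.+ suc (toℕ i)) p)

opK : ∀ r → ℕ → Poly r → Poly r
opK r k p = Dtilde r p +P sumα r k p

-- g_{k,n} for n ≥ 0 (given as a natural number), with a fuel argument
-- bounding the recursion on k (fuel suc ∣k∣ suffices when r ≥ 1).
go : ∀ r → ℕ → ℕ → ℤ → Poly r
go r zero f -[1+ _ ] = 1P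
go r (suc n) f -[1+ _ ] = 0P
go r n zero (+ k) = 0P
go r zero (suc f) (+ k) = opK r k 0P +P go r zero f (+ k - + r)
go r (suc n) (suc f) (+ k) = opK r k (go r n (suc f) (+ k)) +P go r (suc n) f (+ k - + r)

g : ∀ r → ℤ → ℤ → Poly r
g r k -[1+ _ ] = 0P
g r k (+ n) = go r n (suc ∣ k ∣) k

data Step : Set where
  rise fall : Step

allSeqs : ℕ → List (List Step)
allSeqs zero = [] ∷ []
allSeqs (suc n) = map (rise ∷_) (allSeqs n) ++ map (fall ∷_) (allSeqs n)

-- weight of a step sequence starting at height h: the product of the weights
-- (applied as multiplication operators to 1) if it is a valid m-Dyck path
-- (stays in ℕ, ends at height 0), and 0 otherwise.
pathWeight : ∀ {r} (m : ℕ) → (ℕ → Poly r → Poly r) → ℕ → List Step → Poly r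
pathWeight m w h [] = if h ≡ᵇ 0 then 1P else 0P
pathWeight m w h (rise ∷ s) = pathWeight m w (suc h) s
pathWeight m w h (fall ∷ s) = if m ≤ᵇ h then w h (pathWeight m w (h ∸ m) s) else 0P

sumList : ∀ {r} → List (Poly r) → Poly r
sumList [] = 0P
sumList (p ∷ ps) = p +P sumList ps

-- S^{(m)}_n(α): sum over all m-Dyck paths of length (m+1)n of the weights;
-- w i is multiplication by α_i (only used for i ≥ m).
StieltjesRogers : ∀ {r} (m : ℕ) → (ℕ → Poly r → Poly r) → ℕ → Poly r
StieltjesRogers m w n = sumList (map (pathWeight m w 0) (allSeqs (suc m ℕ.* n)))

iterate : ∀ {A : Set} → ℕ → (A → A) → A → A
iterate zero f x = x
iterate (suc n) f x = f (iterate n f x)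

DyPow : ∀ r → ℕ → Poly r
DyPow r n = iterate n (λ p → Dtilde r p +P mulY p) 1P

module Submission where

-- Let L_k = D̃ + α_k + ⋯ + α_{k+r}. The α's commute, and D̃ is a derivation with
-- [D̃, x_j] = x_j Σ_{l≠j} x_l and [D̃, y] = (Σ_l x_l) y; hence [D̃, α_t] = α_t (Σ_l x_l − β_t),
-- where β_t = α_{t+r+1} − α_t is x_{j+1} or 0 according to t mod (r+1). Since the β's over a
-- full period sum to Σ_l x_l, the windows satisfy L_{k+r} − L_k = Σ_l x_l − β_{k+r}, so
--   L_k α_{k+r} = α_{k+r} L_{k+r}.
-- Expanding both sides of (b) at (k, n+1) by the recurrence reduces it to (b) at (k, n), to (b)
-- at (k − r, n+1) and to this identity, so (b) follows by induction on n and then on k.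
-- Read backwards, (b) is the last-step decomposition of r-Dyck paths: g_{k,n} is the weighted
-- count of paths from height 0 to height k with (r+1)n + k steps, and k = 0 gives S_n = g_{0,n}.
-- Finally α_1 = ⋯ = α_{r−1} = 0, α_r = y and g_{−r,n} = 0 for n > 0, so the recurrence at k = 0
-- reads g_{0,n} = (D̃ + y) g_{0,n−1}.

open import Defs
open import Data.Nat using (ℕ; _≤_)
open import Data.Integer using (ℤ; +_; -_; _+_; _-_; ∣_∣)
open import Data.Product using (_×_)

open import Algebra.Bundles using (AbelianGroup)
import Algebra.Construct.Pointwise as Pointwise
import Algebra.Properties.AbelianGroup as AbelianGroupProperties
import Algebra.Properties.CommutativeSemigroup as CommutativeSemigroupProperties
open import Data.Bool using (Bool; true; false; if_then_else_; _∧_; T)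
open import Data.Bool.Properties using (T-∧; T-≡; if-eta)
open import Data.Empty using (⊥-elim)
open import Data.Fin as Fin using (Fin)
import Data.Fin.Properties as FinP
import Data.Integer as ℤ
open import Data.Integer using (_*_; -[1+_])
import Data.Integer.Properties as ℤₚ
open import Data.Integer.Tactic.RingSolver using (solve-∀)
open import Data.List using (List; []; _∷_; map; _++_)
open import Data.List.Properties using (map-++; map-∘)
import Data.Nat as ℕ
open import Data.Nat using (zero; suc)
open import Data.Nat.DivMod using (m<n⇒m/n≡0; m<n⇒m%n≡m; [m+n]%n≡m%n; m/n≡1+[m∸n]/n)
open import Data.Nat.Induction using (<-rec)
import Data.Nat.Properties as ℕₚ
import Data.Nat.Tactic.RingSolver as ℕSolver
open import Data.Product using (Σ; _,_; proj₁; proj₂)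
open import Data.Unit using (⊤; tt)
open import Function.Bundles using (Equivalence)
open import Level using (0ℓ)
open import Relation.Binary.PropositionalEquality using (_≡_; _≢_; refl; cong; cong₂; subst)
import Relation.Binary.PropositionalEquality as ≡
open import Relation.Nullary using (yes; no; does; Dec)

killIfZero-+ : ∀ n x y → killIfZero n (x + y) ≡ killIfZero n x + killIfZero n y
killIfZero-+ zero x y = refl
killIfZero-+ (suc n) x y = refl

killIfZero-* : ∀ n c x → killIfZero n (c * x) ≡ c * killIfZero n x
killIfZero-* zero c x = ≡.sym (ℤₚ.*-zeroʳ c)
killIfZero-* (suc n) c x = refl

killIfZero-0 : ∀ n → killIfZero n (+ 0) ≡ + 0
killIfZero-0 zero = refl
killIfZero-0 (suc n) = refl

killIfZero-comm : ∀ m n x → killIfZero m (killIfZero n x) ≡ killIfZero n (killIfZero m x)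
killIfZero-comm zero zero x = refl
killIfZero-comm zero (suc n) x = refl
killIfZero-comm (suc m) zero x = refl
killIfZero-comm (suc m) (suc n) x = refl

true⇒T : ∀ {b} → b ≡ true → T b
true⇒T = Equivalence.from T-≡

allZero-cong : ∀ n {a a' : Mon n} → (∀ j → a j ≡ a' j) → allZero n a ≡ allZero n a'
allZero-cong zero e = refl
allZero-cong (suc n) e = cong₂ _∧_ (cong (ℕ._≡ᵇ 0) (e Fin.zero)) (allZero-cong n (λ j → e (Fin.suc j)))

allZero⇒≡0 : ∀ n (a : Mon n) → T (allZero n a) → ∀ j → a j ≡ 0
allZero⇒≡0 (suc n) a all0 Fin.zero = ℕₚ.≡ᵇ⇒≡ (a Fin.zero) 0 (proj₁ (T-∧ .Equivalence.to all0))
allZero⇒≡0 (suc n) a all0 (Fin.suc j) = allZero⇒≡0 n (λ j → a (Fin.suc j)) (proj₂ (T-∧ .Equivalence.to all0)) j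

module Operators (r : ℕ) where

  +P-abelianGroup : AbelianGroup 0ℓ 0ℓ
  +P-abelianGroup = Pointwise.abelianGroup (Mon r) (Pointwise.abelianGroup ℕ ℤₚ.+-0-abelianGroup)

  private
    module G = AbelianGroup +P-abelianGroup
    module GP = AbelianGroupProperties +P-abelianGroup
    module SP = CommutativeSemigroupProperties G.commutativeSemigroup

  open G public using (setoid; reflexive) renaming (refl to ≈P-refl; sym to ≈P-sym; trans to ≈P-trans)

  -- The group laws restated in terms of _+P_, with the operands that unification cannot
  -- recover (_+_ on ℤ is not injective) made explicit.
  +P-cong : ∀ {p p' q q'} → p ≈P p' → q ≈P q' → p +P q ≈P p' +P q'
  +P-cong {p} {p'} {q} {q'} = G.∙-cong {p} {p'} {q} {q'}

  +P-congˡ : ∀ p {q q'} → q ≈P q' → p +P q ≈P p +P q'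
  +P-congˡ p {q} {q'} = G.∙-congˡ {p} {q} {q'}

  +P-congʳ : ∀ q {p p'} → p ≈P p' → p +P q ≈P p' +P q
  +P-congʳ q {p} {p'} = G.∙-congʳ {q} {p} {p'}

  +P-comm : ∀ p q → p +P q ≈P q +P p
  +P-comm = G.comm

  +P-assoc : ∀ p q s → (p +P q) +P s ≈P p +P (q +P s)
  +P-assoc = G.assoc

  +P-identityˡ : ∀ p → 0P +P p ≈P p
  +P-identityˡ = G.identityˡ

  +P-identityʳ : ∀ p → p +P 0P ≈P p
  +P-identityʳ = G.identityʳ

  +P-interchange : ∀ p q s t → (p +P q) +P (s +P t) ≈P (p +P s) +P (q +P t)
  +P-interchange = SP.interchange

  +P-cancelʳ : ∀ p q s → q +P p ≈P s +P p → q ≈P s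
  +P-cancelʳ = GP.∙-cancelʳ

  xy+z≈xz+y : ∀ p q s → (p +P q) +P s ≈P (p +P s) +P q
  xy+z≈xz+y = SP.xy∙z≈xz∙y

  x+yz≈xz+y : ∀ p q s → p +P (q +P s) ≈P (p +P s) +P q
  x+yz≈xz+y = SP.x∙yz≈xz∙y

  x+yz≈y+xz : ∀ p q s → p +P (q +P s) ≈P q +P (p +P s)
  x+yz≈y+xz = SP.x∙yz≈y∙xz

  open import Relation.Binary.Reasoning.Setoid setoid public

  Op : Set
  Op = Poly r → Poly r

  -- Monomials are functions, so equality on them is only pointwise; every polynomial
  -- that occurs respects it, and the operators must preserve this.
  _≗M_ : Mon r → Mon r → Set
  a ≗M a' = ∀ j → a j ≡ a' j

  Extensional : Poly r → Set
  Extensional p = ∀ {a a'} → a ≗M a' → ∀ b → p a b ≡ p a' b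

  1P-ext : Extensional 1P
  1P-ext e zero = cong (λ c → if c then + 1 else + 0) (allZero-cong r e)
  1P-ext e (suc b) = refl

  0P-ext : Extensional 0P
  0P-ext e b = refl

  record Linear (L : Op) : Set where
    field
      linear-cong  : ∀ {p q} → p ≈P q → L p ≈P L q
      linear-+     : ∀ p q → L (p +P q) ≈P L p +P L q
      linear-0     : L 0P ≈P 0P
      linear-scale : ∀ c p → L (scale c p) ≈P scale c (L p)
      linear-ext   : ∀ p → Extensional p → Extensional (L p)
  open Linear public

  upd-ext : ∀ {a a'} i f → a ≗M a' → upd a i f ≗M upd a' i f
  upd-ext i f e j = cong (λ x → if does (i Fin.≟ j) then f x else x) (e j)

  upd-self : ∀ (a : Mon r) i f → upd a i f i ≡ f (a i)
  upd-self a i f with i Fin.≟ i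
  ... | yes _ = refl
  ... | no i≢i = ⊥-elim (i≢i refl)

  upd-other : ∀ (a : Mon r) {i j} f → i ≢ j → upd a i f j ≡ a j
  upd-other a {i} {j} f i≢j with i Fin.≟ j
  ... | yes i≡j = ⊥-elim (i≢j i≡j)
  ... | no _ = refl

  upd-upd : ∀ (a : Mon r) i f g → upd (upd a i f) i g ≗M upd a i (λ x → g (f x))
  upd-upd a i f g j with i Fin.≟ j
  ... | yes _ = refl
  ... | no _ = refl

  upd-comm : ∀ (a : Mon r) {i l} f g → i ≢ l → upd (upd a i f) l g ≗M upd (upd a l g) i f
  upd-comm a {i} {l} f g i≢l j with i Fin.≟ j | l Fin.≟ j
  ... | yes refl | yes refl = ⊥-elim (i≢l refl)
  ... | yes _ | no _ = refl
  ... | no _ | yes _ = refl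
  ... | no _ | no _ = refl

  upd-id : ∀ (a : Mon r) i f → (∀ x → f x ≡ x) → upd a i f ≗M a
  upd-id a i f f≗Mid j = ≡.trans (cong (λ x → if does (i Fin.≟ j) then x else a j) (f≗Mid (a j))) (if-eta _)

  upd-suc-pred : ∀ (a : Mon r) i n → a i ≡ suc n → upd a i (λ x → suc (ℕ.pred x)) ≗M a
  upd-suc-pred a i n e j with i Fin.≟ j
  ... | yes refl rewrite e = refl
  ... | no _ = refl

  private
    *-comm-middle : ∀ (m c x : ℤ) → m * (c * x) ≡ c * (m * x)
    *-comm-middle = solve-∀

    [1+s]*x≡x+s*x : ∀ (s x : ℤ) → (+ 1 + s) * x ≡ x + s * x
    [1+s]*x≡x+s*x = solve-∀

  scale-linear : ∀ c → Linear (scale c)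
  scale-linear c = record
    { linear-cong  = λ e a b → cong (c *_) (e a b)
    ; linear-+     = λ p q a b → ℤₚ.*-distribˡ-+ c (p a b) (q a b)
    ; linear-0     = λ a b → ℤₚ.*-zeroʳ c
    ; linear-scale = λ d p a b → *-comm-middle c d (p a b)
    ; linear-ext   = λ p E e b → cong (c *_) (E e b) }

  mulX-linear : ∀ i → Linear (mulX i)
  mulX-linear i = record
    { linear-cong  = λ e a b → cong (killIfZero (a i)) (e _ b)
    ; linear-+     = λ p q a b → killIfZero-+ (a i) _ _
    ; linear-0     = λ a b → killIfZero-0 (a i)
    ; linear-scale = λ c p a b → killIfZero-* (a i) c (p (upd a i ℕ.pred) b)
    ; linear-ext   = λ p E e b → cong₂ killIfZero (e i) (E (upd-ext i ℕ.pred e) b) }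

  mulY-linear : Linear mulY
  mulY-linear = record
    { linear-cong  = λ { e a zero → refl ; e a (suc b) → e a b }
    ; linear-+     = λ { p q a zero → refl ; p q a (suc b) → refl }
    ; linear-0     = λ { a zero → refl ; a (suc b) → refl }
    ; linear-scale = λ { c p a zero → ≡.sym (ℤₚ.*-zeroʳ c) ; c p a (suc b) → refl }
    ; linear-ext   = λ { p E e zero → refl ; p E e (suc b) → E e b } }

  dX-linear : ∀ i → Linear (dX i)
  dX-linear i = record
    { linear-cong  = λ e a b → cong (+ suc (a i) *_) (e _ b)
    ; linear-+     = λ p q a b → ℤₚ.*-distribˡ-+ (+ suc (a i)) (p (upd a i suc) b) (q (upd a i suc) b)
    ; linear-0     = λ a b → ℤₚ.*-zeroʳ (+ suc (a i))
    ; linear-scale = λ c p a b → *-comm-middle (+ suc (a i)) c _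
    ; linear-ext   = λ p E e b → cong₂ (λ u v → + suc u * v) (e i) (E (upd-ext i suc e) b) }

  dY-linear : Linear dY
  dY-linear = record
    { linear-cong  = λ e a b → cong (+ suc b *_) (e a (suc b))
    ; linear-+     = λ p q a b → ℤₚ.*-distribˡ-+ (+ suc b) (p a (suc b)) (q a (suc b))
    ; linear-0     = λ a b → ℤₚ.*-zeroʳ (+ suc b)
    ; linear-scale = λ c p a b → *-comm-middle (+ suc b) c _
    ; linear-ext   = λ p E e b → cong (+ suc b *_) (E e (suc b)) }

  0-linear : Linear (λ _ → 0P)
  0-linear = record
    { linear-cong  = λ _ → ≈P-refl
    ; linear-+     = λ _ _ → ≈P-sym (+P-identityˡ 0P)
    ; linear-0     = ≈P-refl
    ; linear-scale = λ c p a b → ≡.sym (ℤₚ.*-zeroʳ c)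
    ; linear-ext   = λ _ _ _ _ → refl }

  ∘-linear : ∀ {L M} → Linear L → Linear M → Linear (λ p → L (M p))
  ∘-linear {L} {M} lL lM = record
    { linear-cong  = λ e → linear-cong lL (linear-cong lM e)
    ; linear-+     = λ p q → ≈P-trans (linear-cong lL (linear-+ lM p q)) (linear-+ lL _ _)
    ; linear-0     = ≈P-trans (linear-cong lL (linear-0 lM)) (linear-0 lL)
    ; linear-scale = λ c p → ≈P-trans (linear-cong lL (linear-scale lM c p)) (linear-scale lL c (M p))
    ; linear-ext   = λ p E → linear-ext lL (M p) (linear-ext lM p E) }

  +-linear : ∀ {L M} → Linear L → Linear M → Linear (λ p → L p +P M p)
  +-linear {L} {M} lL lM = record
    { linear-cong  = λ e → +P-cong (linear-cong lL e) (linear-cong lM e)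
    ; linear-+     = λ p q → ≈P-trans (+P-cong (linear-+ lL p q) (linear-+ lM p q))
                                      (+P-interchange (L p) (L q) (M p) (M q))
    ; linear-0     = ≈P-trans (+P-cong (linear-0 lL) (linear-0 lM)) (+P-identityˡ 0P)
    ; linear-scale = λ c p → ≈P-trans (+P-cong (linear-scale lL c p) (linear-scale lM c p))
                                      (≈P-sym (linear-+ (scale-linear c) (L p) (M p)))
    ; linear-ext   = λ p E e b → cong₂ _+_ (linear-ext lL p E e b) (linear-ext lM p E e b) }

  if-linear : ∀ c {L} → Linear L → Linear (λ p → if c then 0P else L p)
  if-linear true lL = 0-linear
  if-linear false lL = lL

  sumFin-linear : ∀ n {Ls : Fin n → Op} → (∀ i → Linear (Ls i)) → Linear (λ p → sumFin n (λ i → Ls i p))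
  sumFin-linear zero lLs = 0-linear
  sumFin-linear (suc n) lLs = +-linear (lLs Fin.zero) (sumFin-linear n (λ i → lLs (Fin.suc i)))

  linear-resp : ∀ {L M} → (∀ p → L p ≈P M p) → Linear M → Linear L
  linear-resp {L} {M} L≈M lM = record
    { linear-cong  = λ {p} {q} e → ≈P-trans (L≈M p) (≈P-trans (linear-cong lM e) (≈P-sym (L≈M q)))
    ; linear-+     = λ p q → ≈P-trans (L≈M (p +P q)) (≈P-trans (linear-+ lM p q) (≈P-sym (+P-cong (L≈M p) (L≈M q))))
    ; linear-0     = ≈P-trans (L≈M 0P) (linear-0 lM)
    ; linear-scale = λ c p → ≈P-trans (L≈M (scale c p))
                               (≈P-trans (linear-scale lM c p) (≈P-sym (linear-cong (scale-linear c) (L≈M p))))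
    ; linear-ext   = λ p E {a} {a'} e b → ≡.trans (L≈M p a b) (≡.trans (linear-ext lM p E e b) (≡.sym (L≈M p a' b))) }

  sumFin-cong : ∀ n {f g : Fin n → Poly r} → (∀ i → f i ≈P g i) → sumFin n f ≈P sumFin n g
  sumFin-cong zero e = ≈P-refl
  sumFin-cong (suc n) e = +P-cong (e Fin.zero) (sumFin-cong n (λ i → e (Fin.suc i)))

  sumFin-+ : ∀ n (f g : Fin n → Poly r) → sumFin n (λ i → f i +P g i) ≈P sumFin n f +P sumFin n g
  sumFin-+ zero f g = ≈P-sym (+P-identityˡ 0P)
  sumFin-+ (suc n) f g =
    ≈P-trans (+P-congˡ (f Fin.zero +P g Fin.zero) (sumFin-+ n (λ i → f (Fin.suc i)) (λ i → g (Fin.suc i))))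
             (+P-interchange (f Fin.zero) (g Fin.zero) (sumFin n (λ i → f (Fin.suc i))) (sumFin n (λ i → g (Fin.suc i))))

  sumFin-0 : ∀ n → sumFin n (λ _ → 0P {r}) ≈P 0P
  sumFin-0 zero = ≈P-refl
  sumFin-0 (suc n) = ≈P-trans (+P-identityˡ (sumFin n (λ _ → 0P))) (sumFin-0 n)

  linear-sumFin : ∀ {L : Op} → Linear L → ∀ n (f : Fin n → Poly r) → L (sumFin n f) ≈P sumFin n (λ i → L (f i))
  linear-sumFin {L} lL zero f = linear-0 lL
  linear-sumFin {L} lL (suc n) f =
    ≈P-trans (linear-+ lL (f Fin.zero) (sumFin n (λ i → f (Fin.suc i))))
             (+P-congˡ (L (f Fin.zero)) (linear-sumFin lL n (λ i → f (Fin.suc i))))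

  sumFin-if : ∀ n c (f : Fin n → Poly r) → sumFin n (λ l → if c then f l else 0P) ≈P (if c then sumFin n f else 0P)
  sumFin-if n true f = ≈P-refl
  sumFin-if n false f = sumFin-0 n

  sumFin-select : ∀ n (j : Fin n) (f : Fin n → Poly r) → sumFin n (λ i → if does (i Fin.≟ j) then f i else 0P) ≈P f j
  sumFin-select (suc n) Fin.zero f = ≈P-trans (+P-congˡ (f Fin.zero) (sumFin-0 n)) (+P-identityʳ (f Fin.zero))
  sumFin-select (suc n) (Fin.suc j) f =
    ≈P-trans (+P-identityˡ (sumFin n (λ i → if does (Fin.suc i Fin.≟ Fin.suc j) then f (Fin.suc i) else 0P)))
             (sumFin-select n j (λ i → f (Fin.suc i)))

  sumFin-split : ∀ n (j : Fin n) (f : Fin n → Poly r) →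
    sumFin n f ≈P sumFin n (λ l → if does (j Fin.≟ l) then 0P else f l) +P f j
  sumFin-split (suc n) Fin.zero f =
    ≈P-trans (+P-comm (f Fin.zero) (sumFin n (λ l → f (Fin.suc l))))
             (+P-congʳ (f Fin.zero) (≈P-sym (+P-identityˡ (sumFin n (λ l → f (Fin.suc l))))))
  sumFin-split (suc n) (Fin.suc j) f =
    ≈P-trans (+P-congˡ (f Fin.zero) (sumFin-split n j (λ l → f (Fin.suc l))))
             (≈P-sym (+P-assoc (f Fin.zero) (sumFin n (λ l → if does (j Fin.≟ l) then 0P else f (Fin.suc l))) (f (Fin.suc j))))

  sumUpTo : ℕ → (ℕ → Poly r) → Poly r
  sumUpTo zero F = 0P
  sumUpTo (suc n) F = F 0 +P sumUpTo n (λ i → F (suc i))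

  sumUpTo-cong : ∀ n {F G : ℕ → Poly r} → (∀ i → i ℕ.< n → F i ≈P G i) → sumUpTo n F ≈P sumUpTo n G
  sumUpTo-cong zero e = ≈P-refl
  sumUpTo-cong (suc n) e = +P-cong (e 0 (ℕ.s≤s ℕ.z≤n)) (sumUpTo-cong n (λ i i<n → e (suc i) (ℕ.s≤s i<n)))

  sumUpTo-suc : ∀ n (F : ℕ → Poly r) → sumUpTo (suc n) F ≈P sumUpTo n F +P F n
  sumUpTo-suc zero F = ≈P-trans (+P-identityʳ (F 0)) (≈P-sym (+P-identityˡ (F 0)))
  sumUpTo-suc (suc n) F =
    ≈P-trans (+P-congˡ (F 0) (sumUpTo-suc n (λ i → F (suc i))))
             (≈P-sym (+P-assoc (F 0) (sumUpTo n (λ i → F (suc i))) (F (suc n))))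

  sumUpTo-+ : ∀ n (F G : ℕ → Poly r) → sumUpTo n (λ i → F i +P G i) ≈P sumUpTo n F +P sumUpTo n G
  sumUpTo-+ zero F G = ≈P-sym (+P-identityˡ 0P)
  sumUpTo-+ (suc n) F G =
    ≈P-trans (+P-congˡ (F 0 +P G 0) (sumUpTo-+ n (λ i → F (suc i)) (λ i → G (suc i))))
             (+P-interchange (F 0) (G 0) (sumUpTo n (λ i → F (suc i))) (sumUpTo n (λ i → G (suc i))))

  sumUpTo-0 : ∀ n (F : ℕ → Poly r) → (∀ i → i ℕ.< n → F i ≈P 0P) → sumUpTo n F ≈P 0P
  sumUpTo-0 zero F _ = ≈P-refl
  sumUpTo-0 (suc n) F F≈0 =
    ≈P-trans (+P-cong (F≈0 0 (ℕ.s≤s ℕ.z≤n)) (sumUpTo-0 n (λ i → F (suc i)) (λ i i<n → F≈0 (suc i) (ℕ.s≤s i<n))))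
             (+P-identityˡ 0P)

  linear-sumUpTo : ∀ {L : Op} → Linear L → ∀ n (F : ℕ → Poly r) → L (sumUpTo n F) ≈P sumUpTo n (λ i → L (F i))
  linear-sumUpTo lL zero F = linear-0 lL
  linear-sumUpTo {L} lL (suc n) F =
    ≈P-trans (linear-+ lL (F 0) (sumUpTo n (λ i → F (suc i)))) (+P-congˡ (L (F 0)) (linear-sumUpTo lL n (λ i → F (suc i))))

  sumUpTo-linear : ∀ n {Ls : ℕ → Op} → (∀ i → Linear (Ls i)) → Linear (λ p → sumUpTo n (λ i → Ls i p))
  sumUpTo-linear zero lLs = 0-linear
  sumUpTo-linear (suc n) lLs = +-linear (lLs 0) (sumUpTo-linear n (λ i → lLs (suc i)))

  sumFin≈sumUpTo : ∀ n (F : ℕ → Poly r) → sumFin n (λ i → F (Fin.toℕ i)) ≈P sumUpTo n F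
  sumFin≈sumUpTo zero F = ≈P-refl
  sumFin≈sumUpTo (suc n) F = +P-congˡ (F 0) (sumFin≈sumUpTo n (λ i → F (suc i)))

  sumUpTo-rotate : ∀ n (F : ℕ → Poly r) → sumUpTo n (λ i → F (suc i)) +P F 0 ≈P sumUpTo n F +P F n
  sumUpTo-rotate n F = ≈P-trans (+P-comm (sumUpTo n (λ i → F (suc i))) (F 0)) (sumUpTo-suc n F)

  mulX-comm : ∀ i l p → Extensional p → mulX i (mulX l p) ≈P mulX l (mulX i p)
  mulX-comm i l p E a b = by-cases (i Fin.≟ l)
    where
      by-cases : Dec (i ≡ l) → mulX i (mulX l p) a b ≡ mulX l (mulX i p) a b
      by-cases (yes i≡l) = subst (λ z → mulX i (mulX z p) a b ≡ mulX z (mulX i p) a b) i≡l refl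
      by-cases (no i≢l) =
        ≡.trans (cong₂ (λ u v → killIfZero (a i) (killIfZero u v))
                       (upd-other a ℕ.pred i≢l) (E (upd-comm a ℕ.pred ℕ.pred i≢l) b))
         (≡.trans (killIfZero-comm (a i) (a l) (p (upd (upd a l ℕ.pred) i ℕ.pred) b))
           (cong (λ u → killIfZero (a l) (killIfZero u (p (upd (upd a l ℕ.pred) i ℕ.pred) b)))
                 (≡.sym (upd-other a ℕ.pred (λ e → i≢l (≡.sym e))))))

  mulX-mulY-comm : ∀ i (p : Poly r) → mulX i (mulY p) ≈P mulY (mulX i p)
  mulX-mulY-comm i p a zero = killIfZero-0 (a i)
  mulX-mulY-comm i p a (suc b) = refl

  dX-mulX-comm : ∀ i j p → Extensional p → i ≢ j → dX i (mulX j p) ≈P mulX j (dX i p)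
  dX-mulX-comm i j p E i≢j a b =
    ≡.trans (cong₂ (λ u v → + suc (a i) * killIfZero u v) (upd-other a suc i≢j) (E (upd-comm a suc ℕ.pred i≢j) b))
     (≡.trans (≡.sym (killIfZero-* (a j) (+ suc (a i)) (p (upd (upd a j ℕ.pred) i suc) b)))
       (cong (λ u → killIfZero (a j) (+ suc u * p (upd (upd a j ℕ.pred) i suc) b))
             (≡.sym (upd-other a ℕ.pred (λ e → i≢j (≡.sym e))))))

  dX-mulX-same : ∀ i p → Extensional p → dX i (mulX i p) ≈P p +P mulX i (dX i p)
  dX-mulX-same i p E a b =
    ≡.trans (cong₂ (λ u v → + suc (a i) * killIfZero u v) (upd-self a i suc)
              (E (λ j → ≡.trans (upd-upd a i suc ℕ.pred j) (upd-id a i (λ x → ℕ.pred (suc x)) (λ x → refl) j)) b))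
     (≡.trans (product-rule (a i) (p a b) (p (upd (upd a i ℕ.pred) i suc) b)
                 (λ n ai≡1+n → E (λ j → ≡.trans (upd-upd a i ℕ.pred suc j) (upd-suc-pred a i n ai≡1+n j)) b))
       (cong (λ u → p a b + killIfZero (a i) (+ suc u * p (upd (upd a i ℕ.pred) i suc) b)) (≡.sym (upd-self a i ℕ.pred))))
    where
      -- coefficientwise: (aᵢ + 1) pₐ = pₐ + aᵢ pₐ, the last term being killed when aᵢ = 0
      product-rule : ∀ m (x y : ℤ) → (∀ n → m ≡ suc n → y ≡ x) → + suc m * x ≡ x + killIfZero m (+ suc (ℕ.pred m) * y)
      product-rule zero x y _ = ≡.trans (ℤₚ.*-identityˡ x) (≡.sym (ℤₚ.+-identityʳ x))
      product-rule (suc n) x y y≡x rewrite y≡x n refl = [1+s]*x≡x+s*x (+ suc n) x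

  dX-mulY-comm : ∀ i (p : Poly r) → dX i (mulY p) ≈P mulY (dX i p)
  dX-mulY-comm i p a zero = ℤₚ.*-zeroʳ (+ suc (a i))
  dX-mulY-comm i p a (suc b) = refl

  dY-mulX-comm : ∀ j (p : Poly r) → dY (mulX j p) ≈P mulX j (dY p)
  dY-mulX-comm j p a b = ≡.sym (killIfZero-* (a j) (+ suc b) (p (upd a j ℕ.pred) (suc b)))

  dY-mulY : ∀ (p : Poly r) → dY (mulY p) ≈P p +P mulY (dY p)
  dY-mulY p a zero = ≡.trans (ℤₚ.*-identityˡ (p a zero)) (≡.sym (ℤₚ.+-identityʳ (p a zero)))
  dY-mulY p a (suc b) = [1+s]*x≡x+s*x (+ suc b) (p a (suc b))

  scale-mulX-comm : ∀ c i (p : Poly r) → scale c (mulX i p) ≈P mulX i (scale c p)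
  scale-mulX-comm c i p a b = ≡.sym (killIfZero-* (a i) c (p (upd a i ℕ.pred) b))

  scale-mulY-comm : ∀ c (p : Poly r) → scale c (mulY p) ≈P mulY (scale c p)
  scale-mulY-comm c p a zero = ℤₚ.*-zeroʳ c
  scale-mulY-comm c p a (suc b) = refl

  scale-comm : ∀ c d (p : Poly r) → scale c (scale d p) ≈P scale d (scale c p)
  scale-comm c d p a b = *-comm-middle c d (p a b)

  crossTerm : Fin r → Fin r → Op
  crossTerm i l p = if does (i Fin.≟ l) then 0P else mulX i (mulX l p)

  D̃ₓ D̃ᵧ : Op
  D̃ₓ p = sumFin r (λ i → sumFin r (λ l → crossTerm i l (dX i p)))
  D̃ᵧ p = sumFin r (λ i → mulX i (mulY (dY p)))

  crossTerm-linear : ∀ i l → Linear (crossTerm i l)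
  crossTerm-linear i l = if-linear (does (i Fin.≟ l)) (∘-linear (mulX-linear i) (mulX-linear l))

  Dtilde-linear : Linear (Dtilde r)
  Dtilde-linear =
    +-linear (sumFin-linear r (λ i → sumFin-linear r (λ l → ∘-linear (crossTerm-linear i l) (dX-linear i))))
             (sumFin-linear r (λ i → ∘-linear (mulX-linear i) (∘-linear mulY-linear dY-linear)))

  crossTerm-dX-mulX : ∀ i l j p → Extensional p →
    crossTerm i l (dX i (mulX j p)) ≈P
      mulX j (crossTerm i l (dX i p)) +P (if does (i Fin.≟ j) then crossTerm i l p else 0P)
  crossTerm-dX-mulX i l j p E = by-cases (i Fin.≟ l) (i Fin.≟ j)
    where
      x[i]x[l] : Linear (λ q → mulX i (mulX l q))
      x[i]x[l] = ∘-linear (mulX-linear i) (mulX-linear l)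
      E′ : Extensional (dX i p)
      E′ = linear-ext (dX-linear i) p E

      same : mulX i (mulX l (dX i (mulX i p))) ≈P mulX i (mulX i (mulX l (dX i p))) +P mulX i (mulX l p)
      same = begin
        mulX i (mulX l (dX i (mulX i p)))                        ≈⟨ linear-cong x[i]x[l] (dX-mulX-same i p E) ⟩
        mulX i (mulX l (p +P mulX i (dX i p)))                   ≈⟨ linear-+ x[i]x[l] p (mulX i (dX i p)) ⟩
        mulX i (mulX l p) +P mulX i (mulX l (mulX i (dX i p)))
          ≈⟨ +P-congˡ (mulX i (mulX l p)) (linear-cong (mulX-linear i) (mulX-comm l i (dX i p) E′)) ⟩
        mulX i (mulX l p) +P mulX i (mulX i (mulX l (dX i p)))   ≈⟨ +P-comm (mulX i (mulX l p)) _ ⟩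
        mulX i (mulX i (mulX l (dX i p))) +P mulX i (mulX l p)   ∎

      other : i ≢ j → mulX i (mulX l (dX i (mulX j p))) ≈P mulX j (mulX i (mulX l (dX i p))) +P 0P
      other i≢j = begin
        mulX i (mulX l (dX i (mulX j p)))     ≈⟨ linear-cong x[i]x[l] (dX-mulX-comm i j p E i≢j) ⟩
        mulX i (mulX l (mulX j (dX i p)))     ≈⟨ linear-cong (mulX-linear i) (mulX-comm l j (dX i p) E′) ⟩
        mulX i (mulX j (mulX l (dX i p)))     ≈⟨ mulX-comm i j (mulX l (dX i p)) (linear-ext (mulX-linear l) _ E′) ⟩
        mulX j (mulX i (mulX l (dX i p)))     ≈⟨ +P-identityʳ _ ⟨
        mulX j (mulX i (mulX l (dX i p))) +P 0P ∎

      by-cases : (dl : Dec (i ≡ l)) (dj : Dec (i ≡ j)) →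
        (if does dl then 0P else mulX i (mulX l (dX i (mulX j p)))) ≈P
          mulX j (if does dl then 0P else mulX i (mulX l (dX i p))) +P
          (if does dj then (if does dl then 0P else mulX i (mulX l p)) else 0P)
      by-cases (yes _) (yes _) = ≈P-sym (≈P-trans (+P-identityʳ _) (linear-0 (mulX-linear j)))
      by-cases (yes _) (no _) = ≈P-sym (≈P-trans (+P-identityʳ _) (linear-0 (mulX-linear j)))
      by-cases (no _) (yes i≡j) =
        subst (λ z → mulX i (mulX l (dX i (mulX z p))) ≈P mulX z (mulX i (mulX l (dX i p))) +P mulX i (mulX l p)) i≡j same
      by-cases (no _) (no i≢j) = other i≢j

  Dtilde-mulX : ∀ j p → Extensional p → Dtilde r (mulX j p) ≈P mulX j (Dtilde r p) +P sumFin r (λ l → crossTerm j l p)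
  Dtilde-mulX j p E = begin
    D̃ₓ (mulX j p) +P D̃ᵧ (mulX j p)                          ≈⟨ +P-cong D̃ₓ-mulX D̃ᵧ-mulX ⟩
    (mulX j (D̃ₓ p) +P correction) +P mulX j (D̃ᵧ p)          ≈⟨ xy+z≈xz+y (mulX j (D̃ₓ p)) correction (mulX j (D̃ᵧ p)) ⟩
    (mulX j (D̃ₓ p) +P mulX j (D̃ᵧ p)) +P correction          ≈⟨ +P-congʳ correction (linear-+ (mulX-linear j) (D̃ₓ p) (D̃ᵧ p)) ⟨
    mulX j (Dtilde r p) +P correction                        ∎
    where
      correction : Poly r
      correction = sumFin r (λ l → crossTerm j l p)

      D̃ₓ-mulX : D̃ₓ (mulX j p) ≈P mulX j (D̃ₓ p) +P correction
      D̃ₓ-mulX = begin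
        D̃ₓ (mulX j p)
          ≈⟨ sumFin-cong r (λ i → sumFin-cong r (λ l → crossTerm-dX-mulX i l j p E)) ⟩
        sumFin r (λ i → sumFin r (λ l → mulX j (crossTerm i l (dX i p)) +P selected i l))
          ≈⟨ sumFin-cong r (λ i → sumFin-+ r (λ l → mulX j (crossTerm i l (dX i p))) (selected i)) ⟩
        sumFin r (λ i → sumFin r (λ l → mulX j (crossTerm i l (dX i p))) +P sumFin r (selected i))
          ≈⟨ sumFin-+ r _ (λ i → sumFin r (selected i)) ⟩
        sumFin r (λ i → sumFin r (λ l → mulX j (crossTerm i l (dX i p)))) +P sumFin r (λ i → sumFin r (selected i))
          ≈⟨ +P-cong (≈P-sym (≈P-trans (linear-sumFin (mulX-linear j) r _)
                                       (sumFin-cong r (λ i → linear-sumFin (mulX-linear j) r _))))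
                     (≈P-trans (sumFin-cong r (λ i → sumFin-if r (does (i Fin.≟ j)) (λ l → crossTerm i l p)))
                               (sumFin-select r j (λ i → sumFin r (λ l → crossTerm i l p)))) ⟩
        mulX j (D̃ₓ p) +P correction ∎
        where
          selected : Fin r → Fin r → Poly r
          selected i l = if does (i Fin.≟ j) then crossTerm i l p else 0P

      D̃ᵧ-mulX : D̃ᵧ (mulX j p) ≈P mulX j (D̃ᵧ p)
      D̃ᵧ-mulX = begin
        D̃ᵧ (mulX j p)
          ≈⟨ sumFin-cong r (λ i → begin
               mulX i (mulY (dY (mulX j p)))   ≈⟨ linear-cong (∘-linear (mulX-linear i) mulY-linear) (dY-mulX-comm j p) ⟩
               mulX i (mulY (mulX j (dY p)))   ≈⟨ linear-cong (mulX-linear i) (mulX-mulY-comm j (dY p)) ⟨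
               mulX i (mulX j (mulY (dY p)))   ≈⟨ mulX-comm i j (mulY (dY p)) (linear-ext (∘-linear mulY-linear dY-linear) p E) ⟩
               mulX j (mulX i (mulY (dY p)))   ∎) ⟩
        sumFin r (λ i → mulX j (mulX i (mulY (dY p))))
          ≈⟨ linear-sumFin (mulX-linear j) r (λ i → mulX i (mulY (dY p))) ⟨
        mulX j (D̃ᵧ p) ∎

  Dtilde-mulY : ∀ p → Dtilde r (mulY p) ≈P mulY (Dtilde r p) +P sumFin r (λ i → mulX i (mulY p))
  Dtilde-mulY p = begin
    D̃ₓ (mulY p) +P D̃ᵧ (mulY p)                                    ≈⟨ +P-cong D̃ₓ-mulY D̃ᵧ-mulY ⟩
    mulY (D̃ₓ p) +P (correction +P mulY (D̃ᵧ p))                    ≈⟨ x+yz≈xz+y (mulY (D̃ₓ p)) correction (mulY (D̃ᵧ p)) ⟩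
    (mulY (D̃ₓ p) +P mulY (D̃ᵧ p)) +P correction                    ≈⟨ +P-congʳ correction (linear-+ mulY-linear (D̃ₓ p) (D̃ᵧ p)) ⟨
    mulY (Dtilde r p) +P correction                                ∎
    where
      correction : Poly r
      correction = sumFin r (λ i → mulX i (mulY p))

      crossTerm-dX-mulY : ∀ i l → crossTerm i l (dX i (mulY p)) ≈P mulY (crossTerm i l (dX i p))
      crossTerm-dX-mulY i l = by-cases (does (i Fin.≟ l))
        where
          by-cases : ∀ c → (if c then 0P else mulX i (mulX l (dX i (mulY p))))
                             ≈P mulY (if c then 0P else mulX i (mulX l (dX i p)))
          by-cases true = ≈P-sym (linear-0 mulY-linear)
          by-cases false = begin
            mulX i (mulX l (dX i (mulY p)))   ≈⟨ linear-cong (∘-linear (mulX-linear i) (mulX-linear l)) (dX-mulY-comm i p) ⟩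
            mulX i (mulX l (mulY (dX i p)))   ≈⟨ linear-cong (mulX-linear i) (mulX-mulY-comm l (dX i p)) ⟩
            mulX i (mulY (mulX l (dX i p)))   ≈⟨ mulX-mulY-comm i (mulX l (dX i p)) ⟩
            mulY (mulX i (mulX l (dX i p)))   ∎

      D̃ₓ-mulY : D̃ₓ (mulY p) ≈P mulY (D̃ₓ p)
      D̃ₓ-mulY = ≈P-trans (sumFin-cong r (λ i → sumFin-cong r (crossTerm-dX-mulY i)))
                         (≈P-sym (≈P-trans (linear-sumFin mulY-linear r _)
                                           (sumFin-cong r (λ i → linear-sumFin mulY-linear r _))))

      D̃ᵧ-mulY : D̃ᵧ (mulY p) ≈P correction +P mulY (D̃ᵧ p)
      D̃ᵧ-mulY = begin
        D̃ᵧ (mulY p)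
          ≈⟨ sumFin-cong r (λ i → begin
               mulX i (mulY (dY (mulY p)))                       ≈⟨ linear-cong (∘-linear (mulX-linear i) mulY-linear) (dY-mulY p) ⟩
               mulX i (mulY (p +P mulY (dY p)))                  ≈⟨ linear-+ (∘-linear (mulX-linear i) mulY-linear) p (mulY (dY p)) ⟩
               mulX i (mulY p) +P mulX i (mulY (mulY (dY p)))    ≈⟨ +P-congˡ (mulX i (mulY p)) (mulX-mulY-comm i (mulY (dY p))) ⟩
               mulX i (mulY p) +P mulY (mulX i (mulY (dY p)))    ∎) ⟩
        sumFin r (λ i → mulX i (mulY p) +P mulY (mulX i (mulY (dY p))))
          ≈⟨ sumFin-+ r (λ i → mulX i (mulY p)) (λ i → mulY (mulX i (mulY (dY p)))) ⟩
        correction +P sumFin r (λ i → mulY (mulX i (mulY (dY p))))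
          ≈⟨ +P-congˡ correction (linear-sumFin mulY-linear r (λ i → mulX i (mulY (dY p)))) ⟨
        correction +P mulY (D̃ᵧ p) ∎

  dX-1P : ∀ i → dX i 1P ≈P 0P
  dX-1P i a (suc b) = ℤₚ.*-zeroʳ (+ suc (a i))
  dX-1P i a zero with allZero r (upd a i suc) in all0
  ... | true = ⊥-elim (ℕₚ.0≢1+n (≡.trans (≡.sym (allZero⇒≡0 r (upd a i suc) (true⇒T all0) i)) (upd-self a i suc)))
  ... | false = ℤₚ.*-zeroʳ (+ suc (a i))

  dY-1P : dY {r} 1P ≈P 0P
  dY-1P a b = ℤₚ.*-zeroʳ (+ suc b)

  Dtilde-1P : Dtilde r 1P ≈P 0P
  Dtilde-1P = ≈P-trans (+P-cong D̃ₓ-1P D̃ᵧ-1P) (+P-identityʳ 0P)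
    where
      kill : ∀ {L q} → Linear L → q ≈P 0P → L q ≈P 0P
      kill lL q≈0 = ≈P-trans (linear-cong lL q≈0) (linear-0 lL)

      D̃ₓ-1P : D̃ₓ 1P ≈P 0P
      D̃ₓ-1P = ≈P-trans (sumFin-cong r (λ i → kill (sumFin-linear r (crossTerm-linear i)) (dX-1P i))) (sumFin-0 r)

      D̃ᵧ-1P : D̃ᵧ 1P ≈P 0P
      D̃ᵧ-1P = ≈P-trans (sumFin-cong r (λ i → kill (∘-linear (mulX-linear i) mulY-linear) dY-1P)) (sumFin-0 r)

module AlphaSequence (r : ℕ) where
  open Operators r

  -- Multiplication by α_{q(r+1)+s} for s ≤ r; for q = 0 and s < r this is 0 = α_s too.
  αByDivMod : ℕ → ℕ → Op
  αByDivMod q s p with s ℕ.<? r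
  ... | yes s<r = scale (+ q) (mulX (Fin.fromℕ< s<r) p)
  ... | no _ = mulY p

  -- Multiplication by α_{t+r+1} − α_t, where s = t mod (r+1).
  αIncrement : ℕ → Op
  αIncrement s p with s ℕ.<? r
  ... | yes s<r = mulX (Fin.fromℕ< s<r) p
  ... | no _ = 0P

  αByDivMod-linear : ∀ q s → Linear (αByDivMod q s)
  αByDivMod-linear q s with s ℕ.<? r
  ... | yes s<r = ∘-linear (scale-linear (+ q)) (mulX-linear (Fin.fromℕ< s<r))
  ... | no _ = mulY-linear

  αact≈αByDivMod : ∀ t p → αact r t p ≈P αByDivMod (t ℕ./ suc r) (t ℕ.% suc r) p
  αact≈αByDivMod t p with t ℕ.<? r
  ... | yes t<r = begin
    0P                                    ≈⟨ αByDivMod-0 ⟨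
    αByDivMod 0 t p                       ≡⟨ cong₂ (λ q s → αByDivMod q s p) (≡.sym (m<n⇒m/n≡0 t<1+r)) (≡.sym (m<n⇒m%n≡m t<1+r)) ⟩
    αByDivMod (t ℕ./ suc r) (t ℕ.% suc r) p ∎
    where
      t<1+r : t ℕ.< suc r
      t<1+r = ℕₚ.m<n⇒m<1+n t<r
      αByDivMod-0 : αByDivMod 0 t p ≈P 0P
      αByDivMod-0 with t ℕ.<? r
      ... | yes t<r′ = λ a b → ℤₚ.*-zeroˡ (mulX (Fin.fromℕ< t<r′) p a b)
      ... | no t≮r = ⊥-elim (t≮r t<r)
  ... | no _ with t ℕ.% suc r ℕ.<? r
  ...   | yes _ = ≈P-refl
  ...   | no _ = ≈P-refl

  αact-linear : ∀ t → Linear (αact r t)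
  αact-linear t = linear-resp (αact≈αByDivMod t) (αByDivMod-linear _ _)

  sumα-linear : ∀ k → Linear (sumα r k)
  sumα-linear k = sumFin-linear r (λ i → αact-linear _)

  opK-linear : ∀ k → Linear (opK r k)
  opK-linear k = +-linear Dtilde-linear (sumα-linear k)

  αByDivMod-comm : ∀ q s q′ s′ p → Extensional p →
    αByDivMod q s (αByDivMod q′ s′ p) ≈P αByDivMod q′ s′ (αByDivMod q s p)
  αByDivMod-comm q s q′ s′ p E with s ℕ.<? r | s′ ℕ.<? r
  ... | yes s<r | yes s′<r = begin
    scale c (mulX j (scale c′ (mulX j′ p)))   ≈⟨ linear-cong (scale-linear c) (scale-mulX-comm c′ j (mulX j′ p)) ⟨
    scale c (scale c′ (mulX j (mulX j′ p)))   ≈⟨ scale-comm c c′ (mulX j (mulX j′ p)) ⟩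
    scale c′ (scale c (mulX j (mulX j′ p)))   ≈⟨ linear-cong (∘-linear (scale-linear c′) (scale-linear c)) (mulX-comm j j′ p E) ⟩
    scale c′ (scale c (mulX j′ (mulX j p)))   ≈⟨ linear-cong (scale-linear c′) (scale-mulX-comm c j′ (mulX j p)) ⟩
    scale c′ (mulX j′ (scale c (mulX j p)))   ∎
    where
      c c′ : ℤ
      c = + q
      c′ = + q′
      j j′ : Fin r
      j = Fin.fromℕ< s<r
      j′ = Fin.fromℕ< s′<r
  ... | yes s<r | no _ =
    ≈P-trans (linear-cong (scale-linear (+ q)) (mulX-mulY-comm j p)) (scale-mulY-comm (+ q) (mulX j p))
    where
      j : Fin r
      j = Fin.fromℕ< s<r
  ... | no _ | yes s′<r =
    ≈P-sym (≈P-trans (linear-cong (scale-linear (+ q′)) (mulX-mulY-comm j′ p)) (scale-mulY-comm (+ q′) (mulX j′ p)))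
    where
      j′ : Fin r
      j′ = Fin.fromℕ< s′<r
  ... | no _ | no _ = ≈P-refl

  αact-comm : ∀ s t p → Extensional p → αact r s (αact r t p) ≈P αact r t (αact r s p)
  αact-comm s t p E = begin
    αact r s (αact r t p)       ≈⟨ αact≈αByDivMod s (αact r t p) ⟩
    A[s] (αact r t p)           ≈⟨ linear-cong (αByDivMod-linear _ _) (αact≈αByDivMod t p) ⟩
    A[s] (A[t] p)               ≈⟨ αByDivMod-comm _ _ _ _ p E ⟩
    A[t] (A[s] p)               ≈⟨ linear-cong (αByDivMod-linear _ _) (αact≈αByDivMod s p) ⟨
    A[t] (αact r s p)           ≈⟨ αact≈αByDivMod t (αact r s p) ⟨
    αact r t (αact r s p)       ∎
    where
      A[s] A[t] : Op
      A[s] = αByDivMod (s ℕ./ suc r) (s ℕ.% suc r)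
      A[t] = αByDivMod (t ℕ./ suc r) (t ℕ.% suc r)

  αact-below : ∀ t p → t ℕ.< r → αact r t p ≈P 0P
  αact-below t p t<r with t ℕ.<? r
  ... | yes _ = ≈P-refl
  ... | no t≮r = ⊥-elim (t≮r t<r)

  αact-r : ∀ p → αact r r p ≈P mulY p
  αact-r p with r ℕ.<? r
  ... | yes r<r = ⊥-elim (ℕₚ.<-irrefl refl r<r)
  ... | no _ with r ℕ.% suc r ℕ.<? r
  ...   | yes r%<r = ⊥-elim (ℕₚ.<-irrefl refl (subst (ℕ._< r) (m<n⇒m%n≡m (ℕₚ.n<1+n r)) r%<r))
  ...   | no _ = ≈P-refl

  αByDivMod-suc : ∀ q s p → αByDivMod (suc q) s p ≈P αByDivMod q s p +P αIncrement s p
  αByDivMod-suc q s p with s ℕ.<? r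
  ... | yes s<r = λ a b → [1+q]*x≡q*x+x (+ q) (mulX (Fin.fromℕ< s<r) p a b)
    where
      [1+q]*x≡q*x+x : ∀ (q x : ℤ) → (+ 1 + q) * x ≡ q * x + x
      [1+q]*x≡q*x+x = solve-∀
  ... | no _ = ≈P-sym (+P-identityʳ (mulY p))

  αact-+period : ∀ t p → αact r (t ℕ.+ suc r) p ≈P αact r t p +P αIncrement (t ℕ.% suc r) p
  αact-+period t p = begin
    αact r (t ℕ.+ suc r) p
      ≈⟨ αact≈αByDivMod (t ℕ.+ suc r) p ⟩
    αByDivMod ((t ℕ.+ suc r) ℕ./ suc r) ((t ℕ.+ suc r) ℕ.% suc r) p
      ≡⟨ cong₂ (λ q s → αByDivMod q s p) quotient ([m+n]%n≡m%n t (suc r)) ⟩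
    αByDivMod (suc (t ℕ./ suc r)) (t ℕ.% suc r) p
      ≈⟨ αByDivMod-suc (t ℕ./ suc r) (t ℕ.% suc r) p ⟩
    αByDivMod (t ℕ./ suc r) (t ℕ.% suc r) p +P αIncrement (t ℕ.% suc r) p
      ≈⟨ +P-congʳ (αIncrement (t ℕ.% suc r) p) (αact≈αByDivMod t p) ⟨
    αact r t p +P αIncrement (t ℕ.% suc r) p ∎
    where
      quotient : (t ℕ.+ suc r) ℕ./ suc r ≡ suc (t ℕ./ suc r)
      quotient = ≡.trans (m/n≡1+[m∸n]/n (ℕₚ.m≤n+m (suc r) t)) (cong (λ z → suc (z ℕ./ suc r)) (ℕₚ.m+n∸n≡m t (suc r)))

  mulΣx : Op
  mulΣx h = sumFin r (λ l → mulX l h)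

  αIncrement-period-sum : ∀ k h → sumUpTo (suc r) (λ i → αIncrement ((k ℕ.+ i) ℕ.% suc r) h) ≈P mulΣx h
  αIncrement-period-sum zero h = begin
    sumUpTo (suc r) (λ i → αIncrement (i ℕ.% suc r) h)
      ≈⟨ sumUpTo-cong (suc r) (λ i i<1+r → reflexive (cong (λ s → αIncrement s h) (m<n⇒m%n≡m i<1+r))) ⟩
    sumUpTo (suc r) (λ i → αIncrement i h)
      ≈⟨ sumUpTo-suc r (λ i → αIncrement i h) ⟩
    sumUpTo r (λ i → αIncrement i h) +P αIncrement r h
      ≈⟨ +P-congˡ (sumUpTo r (λ i → αIncrement i h)) αIncrement-r ⟩
    sumUpTo r (λ i → αIncrement i h) +P 0P
      ≈⟨ +P-identityʳ _ ⟩
    sumUpTo r (λ i → αIncrement i h)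
      ≈⟨ sumFin≈sumUpTo r (λ i → αIncrement i h) ⟨
    sumFin r (λ l → αIncrement (Fin.toℕ l) h)
      ≈⟨ sumFin-cong r (λ l → αIncrement-toℕ l) ⟩
    mulΣx h ∎
    where
      αIncrement-r : αIncrement r h ≈P 0P
      αIncrement-r with r ℕ.<? r
      ... | yes r<r = ⊥-elim (ℕₚ.<-irrefl refl r<r)
      ... | no _ = ≈P-refl

      αIncrement-toℕ : ∀ l → αIncrement (Fin.toℕ l) h ≈P mulX l h
      αIncrement-toℕ l with Fin.toℕ l ℕ.<? r
      ... | yes l<r = reflexive (cong (λ j → mulX j h) (FinP.fromℕ<-toℕ l l<r))
      ... | no l≮r = ⊥-elim (l≮r (FinP.toℕ<n l))
  αIncrement-period-sum (suc k) h = +P-cancelʳ (F 0) _ _ (begin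
    sumUpTo (suc r) (λ i → αIncrement ((suc k ℕ.+ i) ℕ.% suc r) h) +P F 0
      ≈⟨ +P-congʳ (F 0) (sumUpTo-cong (suc r) (λ i _ → reflexive (cong (λ t → αIncrement (t ℕ.% suc r) h) (≡.sym (ℕₚ.+-suc k i))))) ⟩
    sumUpTo (suc r) (λ i → F (suc i)) +P F 0
      ≈⟨ sumUpTo-rotate (suc r) F ⟩
    sumUpTo (suc r) F +P F (suc r)
      ≡⟨ cong (λ t → sumUpTo (suc r) F +P αIncrement t h) F-periodic ⟩
    sumUpTo (suc r) F +P F 0
      ≈⟨ +P-congʳ (F 0) (αIncrement-period-sum k h) ⟩
    mulΣx h +P F 0 ∎)
    where
      F : ℕ → Poly r
      F i = αIncrement ((k ℕ.+ i) ℕ.% suc r) h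

      F-periodic : (k ℕ.+ suc r) ℕ.% suc r ≡ (k ℕ.+ 0) ℕ.% suc r
      F-periodic = ≡.trans ([m+n]%n≡m%n k (suc r)) (cong (ℕ._% suc r) (≡.sym (ℕₚ.+-identityʳ k)))

  Dtilde-αByDivMod : ∀ q s h → Extensional h →
    Dtilde r (αByDivMod q s h) +P αByDivMod q s (αIncrement s h) ≈P αByDivMod q s (Dtilde r h) +P αByDivMod q s (mulΣx h)
  Dtilde-αByDivMod q s h E with s ℕ.<? r
  ... | yes s<r = begin
    Dtilde r (c· (mulX j h)) +P c· (mulX j (mulX j h))
      ≈⟨ +P-congʳ (c· (mulX j (mulX j h))) (≈P-trans (linear-scale Dtilde-linear c (mulX j h))
                                                     (linear-cong (scale-linear c) (Dtilde-mulX j h E))) ⟩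
    c· (mulX j (Dtilde r h) +P cross) +P c· (mulX j (mulX j h))
      ≈⟨ +P-congʳ (c· (mulX j (mulX j h))) (linear-+ (scale-linear c) (mulX j (Dtilde r h)) cross) ⟩
    (c· (mulX j (Dtilde r h)) +P c· cross) +P c· (mulX j (mulX j h))
      ≈⟨ +P-assoc (c· (mulX j (Dtilde r h))) (c· cross) (c· (mulX j (mulX j h))) ⟩
    c· (mulX j (Dtilde r h)) +P (c· cross +P c· (mulX j (mulX j h)))
      ≈⟨ +P-congˡ (c· (mulX j (Dtilde r h))) (linear-+ (scale-linear c) cross (mulX j (mulX j h))) ⟨
    c· (mulX j (Dtilde r h)) +P c· (cross +P mulX j (mulX j h))
      ≈⟨ +P-congˡ (c· (mulX j (Dtilde r h))) (linear-cong (scale-linear c) x[j]Σx) ⟨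
    c· (mulX j (Dtilde r h)) +P c· (mulX j (mulΣx h)) ∎
    where
      c : ℤ
      c = + q
      j : Fin r
      j = Fin.fromℕ< s<r
      c· : Op
      c· = scale c
      cross : Poly r
      cross = sumFin r (λ l → crossTerm j l h)
      x[j]Σx : mulX j (mulΣx h) ≈P cross +P mulX j (mulX j h)
      x[j]Σx = ≈P-trans (linear-sumFin (mulX-linear j) r (λ l → mulX l h))
                        (sumFin-split r j (λ l → mulX j (mulX l h)))
  ... | no _ = begin
    Dtilde r (mulY h) +P mulY 0P                           ≈⟨ +P-cong (Dtilde-mulY h) (linear-0 mulY-linear) ⟩
    (mulY (Dtilde r h) +P sumFin r (λ i → mulX i (mulY h))) +P 0P
      ≈⟨ +P-identityʳ _ ⟩
    mulY (Dtilde r h) +P sumFin r (λ i → mulX i (mulY h))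
      ≈⟨ +P-congˡ (mulY (Dtilde r h)) (sumFin-cong r (λ i → mulX-mulY-comm i h)) ⟩
    mulY (Dtilde r h) +P sumFin r (λ i → mulY (mulX i h))
      ≈⟨ +P-congˡ (mulY (Dtilde r h)) (linear-sumFin mulY-linear r (λ l → mulX l h)) ⟨
    mulY (Dtilde r h) +P mulY (mulΣx h) ∎

  Dtilde-αact : ∀ t h → Extensional h →
    Dtilde r (αact r t h) +P αact r t (αIncrement (t ℕ.% suc r) h) ≈P αact r t (Dtilde r h) +P αact r t (mulΣx h)
  Dtilde-αact t h E = begin
    Dtilde r (αact r t h) +P αact r t (αIncrement s h)
      ≈⟨ +P-cong (linear-cong Dtilde-linear (αact≈αByDivMod t h)) (αact≈αByDivMod t (αIncrement s h)) ⟩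
    Dtilde r (αByDivMod q s h) +P αByDivMod q s (αIncrement s h)
      ≈⟨ Dtilde-αByDivMod q s h E ⟩
    αByDivMod q s (Dtilde r h) +P αByDivMod q s (mulΣx h)
      ≈⟨ +P-cong (αact≈αByDivMod t (Dtilde r h)) (αact≈αByDivMod t (mulΣx h)) ⟨
    αact r t (Dtilde r h) +P αact r t (mulΣx h) ∎
    where
      q s : ℕ
      q = t ℕ./ suc r
      s = t ℕ.% suc r

  αWindow : ℕ → Op
  αWindow k X = sumUpTo (suc r) (λ i → αact r (k ℕ.+ i) X)

  shiftOp : ℕ → Op
  shiftOp k X = Dtilde r X +P αWindow k X

  shiftOp-linear : ∀ k → Linear (shiftOp k)
  shiftOp-linear k = +-linear Dtilde-linear (sumUpTo-linear (suc r) (λ i → αact-linear (k ℕ.+ i)))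

  sumα+αact : ∀ k X → sumα r k X +P αact r k X ≈P αWindow k X
  sumα+αact k X = begin
    sumα r k X +P αact r k X                                                ≈⟨ +P-cong sumα≈ α≈ ⟩
    sumUpTo r (λ i → αact r (k ℕ.+ suc i) X) +P αact r (k ℕ.+ 0) X          ≈⟨ +P-comm _ (αact r (k ℕ.+ 0) X) ⟩
    αWindow k X                                                             ∎
    where
      sumα≈ : sumα r k X ≈P sumUpTo r (λ i → αact r (k ℕ.+ suc i) X)
      sumα≈ = sumFin≈sumUpTo r (λ i → αact r (k ℕ.+ suc i) X)
      α≈ : αact r k X ≈P αact r (k ℕ.+ 0) X
      α≈ = reflexive (cong (λ t → αact r t X) (≡.sym (ℕₚ.+-identityʳ k)))

  opK+αact : ∀ k X → opK r k X +P αact r k X ≈P shiftOp k X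
  opK+αact k X = ≈P-trans (+P-assoc (Dtilde r X) (sumα r k X) (αact r k X)) (+P-congˡ (Dtilde r X) (sumα+αact k X))

  αWindow-+r : ∀ k h → αWindow (k ℕ.+ r) h +P αIncrement ((k ℕ.+ r) ℕ.% suc r) h ≈P αWindow k h +P mulΣx h
  αWindow-+r k h = begin
    (a ((k ℕ.+ r) ℕ.+ 0) +P sumUpTo r (λ i → a ((k ℕ.+ r) ℕ.+ suc i))) +P B r
      ≈⟨ +P-congʳ (B r) (+P-cong (reflexive (cong a (ℕₚ.+-identityʳ (k ℕ.+ r)))) shifted) ⟩
    (a (k ℕ.+ r) +P (sumUpTo r a′ +P sumUpTo r B)) +P B r
      ≈⟨ rearrange (a (k ℕ.+ r)) (sumUpTo r a′) (sumUpTo r B) (B r) ⟩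
    (sumUpTo r a′ +P a (k ℕ.+ r)) +P (sumUpTo r B +P B r)
      ≈⟨ +P-cong (sumUpTo-suc r a′) (sumUpTo-suc r B) ⟨
    αWindow k h +P sumUpTo (suc r) B
      ≈⟨ +P-congˡ (αWindow k h) (αIncrement-period-sum k h) ⟩
    αWindow k h +P mulΣx h ∎
    where
      a a′ B : ℕ → Poly r
      a t = αact r t h
      a′ i = a (k ℕ.+ i)
      B i = αIncrement ((k ℕ.+ i) ℕ.% suc r) h

      index : ∀ k r i → (k ℕ.+ r) ℕ.+ suc i ≡ (k ℕ.+ i) ℕ.+ suc r
      index = ℕSolver.solve-∀

      shifted : sumUpTo r (λ i → a ((k ℕ.+ r) ℕ.+ suc i)) ≈P sumUpTo r a′ +P sumUpTo r B
      shifted = ≈P-trans (sumUpTo-cong r (λ i _ → ≈P-trans (reflexive (cong a (index k r i))) (αact-+period (k ℕ.+ i) h)))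
                         (sumUpTo-+ r a′ B)

      rearrange : ∀ x y z w → (x +P (y +P z)) +P w ≈P (y +P x) +P (z +P w)
      rearrange x y z w a b = ℤ-rearrange (x a b) (y a b) (z a b) (w a b)
        where
          ℤ-rearrange : ∀ (x y z w : ℤ) → (x + (y + z)) + w ≡ (y + x) + (z + w)
          ℤ-rearrange = solve-∀

  αWindow-αact-comm : ∀ k t h → Extensional h → αWindow k (αact r t h) ≈P αact r t (αWindow k h)
  αWindow-αact-comm k t h E =
    ≈P-trans (sumUpTo-cong (suc r) (λ i _ → αact-comm (k ℕ.+ i) t h E))
             (≈P-sym (linear-sumUpTo (αact-linear t) (suc r) (λ i → αact r (k ℕ.+ i) h)))

  shiftOp-intertwines : ∀ k h → Extensional h → shiftOp k (αact r (k ℕ.+ r) h) ≈P αact r (k ℕ.+ r) (shiftOp (k ℕ.+ r) h)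
  shiftOp-intertwines k h E = +P-cancelʳ (αₜ (B h)) _ _ (begin
    (Dtilde r (αₜ h) +P αWindow k (αₜ h)) +P αₜ (B h)
      ≈⟨ xy+z≈xz+y (Dtilde r (αₜ h)) (αWindow k (αₜ h)) (αₜ (B h)) ⟩
    (Dtilde r (αₜ h) +P αₜ (B h)) +P αWindow k (αₜ h)
      ≈⟨ +P-cong (Dtilde-αact t h E) (αWindow-αact-comm k t h E) ⟩
    (αₜ (Dtilde r h) +P αₜ (mulΣx h)) +P αₜ (αWindow k h)
      ≈⟨ x+yz≈xz+y (αₜ (Dtilde r h)) (αₜ (αWindow k h)) (αₜ (mulΣx h)) ⟨
    αₜ (Dtilde r h) +P (αₜ (αWindow k h) +P αₜ (mulΣx h))
      ≈⟨ +P-congˡ (αₜ (Dtilde r h)) (linear-+ (αact-linear t) (αWindow k h) (mulΣx h)) ⟨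
    αₜ (Dtilde r h) +P αₜ (αWindow k h +P mulΣx h)
      ≈⟨ +P-congˡ (αₜ (Dtilde r h)) (linear-cong (αact-linear t) (αWindow-+r k h)) ⟨
    αₜ (Dtilde r h) +P αₜ (αWindow t h +P B h)
      ≈⟨ +P-congˡ (αₜ (Dtilde r h)) (linear-+ (αact-linear t) (αWindow t h) (B h)) ⟩
    αₜ (Dtilde r h) +P (αₜ (αWindow t h) +P αₜ (B h))
      ≈⟨ +P-assoc (αₜ (Dtilde r h)) (αₜ (αWindow t h)) (αₜ (B h)) ⟨
    (αₜ (Dtilde r h) +P αₜ (αWindow t h)) +P αₜ (B h)
      ≈⟨ +P-congʳ (αₜ (B h)) (linear-+ (αact-linear t) (Dtilde r h) (αWindow t h)) ⟨
    αₜ (shiftOp t h) +P αₜ (B h) ∎)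
    where
      t : ℕ
      t = k ℕ.+ r
      αₜ B : Op
      αₜ = αact r t
      B = αIncrement (t ℕ.% suc r)

  -- opK (k − 1), also meaningful for k = 0
  opKPred : ℕ → Op
  opKPred k X = Dtilde r X +P sumUpTo r (λ i → αact r (k ℕ.+ i) X)

  shiftOp≈opKPred+αact : ∀ k X → shiftOp k X ≈P opKPred k X +P αact r (k ℕ.+ r) X
  shiftOp≈opKPred+αact k X =
    ≈P-trans (+P-congˡ (Dtilde r X) (sumUpTo-suc r (λ i → αact r (k ℕ.+ i) X)))
             (≈P-sym (+P-assoc (Dtilde r X) (sumUpTo r (λ i → αact r (k ℕ.+ i) X)) (αact r (k ℕ.+ r) X)))

module Recurrence (r : ℕ) (1≤r : 1 ≤ r) where
  open Operators r
  open AlphaSequence r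

  +k-+r≡+[k∸r] : ∀ {k} → r ℕ.≤ k → + k - + r ≡ + (k ℕ.∸ r)
  +k-+r≡+[k∸r] {k} r≤k = ≡.trans (ℤₚ.m-n≡m⊖n k r) (ℤₚ.⊖-≥ r≤k)

  +k-+r<0 : ∀ {k} → k ℕ.< r → Σ ℕ (λ j → + k - + r ≡ -[1+ j ])
  +k-+r<0 {k} k<r with r ℕ.∸ k | ℕₚ.m<n⇒0<n∸m k<r | ≡.trans (ℤₚ.m-n≡m⊖n k r) (ℤₚ.⊖-< k<r)
  ... | suc j | _ | eq = j , eq

  +[k+r]-+r≡+k : ∀ k → + (k ℕ.+ r) - + r ≡ + k
  +[k+r]-+r≡+k k = ≡.trans (+k-+r≡+[k∸r] (ℕₚ.m≤n+m r k)) (cong +_ (ℕₚ.m+n∸n≡m k r))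

  -- Fuel f suffices for g at index z when z < f; negative indices need no fuel.
  Fueled : ℕ → ℤ → Set
  Fueled f (+ k) = k ℕ.< f
  Fueled f -[1+ _ ] = ⊤

  fueled-∣∣ : ∀ z → Fueled (suc ∣ z ∣) z
  fueled-∣∣ (+ k) = ℕₚ.n<1+n k
  fueled-∣∣ -[1+ _ ] = tt

  fueled-−r : ∀ k f → k ℕ.< suc f → Fueled f (+ k - + r)
  fueled-−r k f k<1+f with r ℕ.≤? k
  ... | yes r≤k = subst (Fueled f) (≡.sym (+k-+r≡+[k∸r] r≤k))
                        (ℕₚ.<-≤-trans (ℕₚ.∸-monoʳ-< 1≤r r≤k) (ℕₚ.m<1+n⇒m≤n k<1+f))
  ... | no r≰k = subst (Fueled f) (≡.sym (proj₂ (+k-+r<0 (ℕₚ.≰⇒> r≰k)))) tt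

  go-fuel : ∀ n f f′ z → Fueled f z → Fueled f′ z → go r n f z ≈P go r n f′ z
  go-fuel zero f f′ -[1+ _ ] _ _ = ≈P-refl
  go-fuel (suc n) f f′ -[1+ _ ] _ _ = ≈P-refl
  go-fuel zero (suc f) (suc f′) (+ k) k<1+f k<1+f′ =
    +P-congˡ (opK r k 0P) (go-fuel zero f f′ (+ k - + r) (fueled-−r k f k<1+f) (fueled-−r k f′ k<1+f′))
  go-fuel (suc n) (suc f) (suc f′) (+ k) k<1+f k<1+f′ =
    +P-cong (linear-cong (opK-linear k) (go-fuel n (suc f) (suc f′) (+ k) k<1+f k<1+f′))
            (go-fuel (suc n) f f′ (+ k - + r) (fueled-−r k f k<1+f) (fueled-−r k f′ k<1+f′))

  g-rec : ∀ k n → g r (+ k) (+ n) ≈P opK r k (g r (+ k) (+ n - + 1)) +P g r (+ k - + r) (+ n)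
  g-rec k zero =
    +P-congˡ (opK r k 0P) (go-fuel zero k _ (+ k - + r) (fueled-−r k k (ℕₚ.n<1+n k)) (fueled-∣∣ _))
  g-rec k (suc n) =
    +P-congˡ (opK r k (g r (+ k) (+ n))) (go-fuel (suc n) k _ (+ k - + r) (fueled-−r k k (ℕₚ.n<1+n k)) (fueled-∣∣ _))

  g-0 : ∀ z → g r z (+ 0) ≈P 1P
  g-0 z = go-0 (suc ∣ z ∣) z (fueled-∣∣ z)
    where
      go-0 : ∀ f z → Fueled f z → go r 0 f z ≈P 1P
      go-0 f -[1+ _ ] _ = ≈P-refl
      go-0 (suc f) (+ k) k<1+f =
        ≈P-trans (+P-cong (linear-0 (opK-linear k)) (go-0 f (+ k - + r) (fueled-−r k f k<1+f))) (+P-identityˡ 1P)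

  g-ext : ∀ z w → Extensional (g r z w)
  g-ext z -[1+ _ ] = 0P-ext
  g-ext z (+ n) = go-ext n (suc ∣ z ∣) z
    where
      go-ext : ∀ n f z → Extensional (go r n f z)
      go-ext zero f -[1+ _ ] = 1P-ext
      go-ext (suc n) f -[1+ _ ] = 0P-ext
      go-ext zero zero (+ k) = 0P-ext
      go-ext (suc n) zero (+ k) = 0P-ext
      go-ext zero (suc f) (+ k) e b = cong₂ _+_ (linear-ext (opK-linear k) 0P 0P-ext e b) (go-ext zero f (+ k - + r) e b)
      go-ext (suc n) (suc f) (+ k) e b =
        cong₂ _+_ (linear-ext (opK-linear k) _ (go-ext n (suc f) (+ k)) e b) (go-ext (suc n) f (+ k - + r) e b)

  δ₀ : ℕ → Poly r
  δ₀ zero = 1P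
  δ₀ (suc _) = 0P

  g-neg : ∀ {z j} n → z ≡ -[1+ j ] → g r z (+ n) ≈P δ₀ n
  g-neg zero refl = ≈P-refl
  g-neg (suc n) refl = ≈P-refl

  g-rec-pred : ∀ k m → g r (+ k - + 1) (+ suc m) ≈P opKPred k (g r (+ k - + 1) (+ m)) +P g r ((+ k - + 1) - + r) (+ suc m)
  g-rec-pred zero m = ≈P-sym (begin
    opKPred 0 (g r -[1+ 0 ] (+ m)) +P g r (-[1+ 0 ] - + r) (+ suc m)   ≈⟨ +P-cong (opKPred-g-1 m) (g-neg (suc m) (-1-+r r)) ⟩
    0P +P 0P                                                            ≈⟨ +P-identityˡ 0P ⟩
    0P                                                                  ∎)
    where
      -1-+r : ∀ n → -[1+ 0 ] - + n ≡ -[1+ n ]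
      -1-+r zero = refl
      -1-+r (suc n) = refl

      sumUpTo-α-0 : ∀ X → sumUpTo r (λ i → αact r (0 ℕ.+ i) X) ≈P 0P
      sumUpTo-α-0 X = sumUpTo-0 r _ (λ i i<r → αact-below i X i<r)

      opKPred-g-1 : ∀ m → opKPred 0 (g r -[1+ 0 ] (+ m)) ≈P 0P
      opKPred-g-1 zero = ≈P-trans (+P-cong Dtilde-1P (sumUpTo-α-0 1P)) (+P-identityʳ 0P)
      opKPred-g-1 (suc m) = ≈P-trans (+P-cong (linear-0 Dtilde-linear) (sumUpTo-α-0 0P)) (+P-identityʳ 0P)
  g-rec-pred (suc k) m =
    ≈P-trans (g-rec k (suc m))
             (+P-congʳ (g r (+ k - + r) (+ suc m))
                       (+P-congˡ (Dtilde r (g r (+ k) (+ m)))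
                                 (≈P-trans (sumFin≈sumUpTo r (λ i → αact r (k ℕ.+ suc i) (g r (+ k) (+ m))))
                                           (sumUpTo-cong r (λ i _ → reflexive (cong (λ t → αact r t (g r (+ k) (+ m))) (ℕₚ.+-suc k i)))))))

  DifferenceAbove : ℕ → ℕ → Set
  DifferenceAbove k n = g r (+ k) (+ n) ≈P g r (+ k - + 1) (+ n) +P αact r (k ℕ.+ r) (g r (+ (k ℕ.+ r)) (+ n - + 1))

  DifferenceAt : ℕ → ℕ → Set
  DifferenceAt t n = g r (+ t - + r) (+ n) ≈P g r ((+ t - + r) - + 1) (+ n) +P αact r t (g r (+ t) (+ n - + 1))

  differenceAbove⇒differenceAt : ∀ k n → DifferenceAbove k n → DifferenceAt (k ℕ.+ r) n
  differenceAbove⇒differenceAt k n =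
    subst (λ z → g r z (+ n) ≈P g r (z - + 1) (+ n) +P αact r (k ℕ.+ r) (g r (+ (k ℕ.+ r)) (+ n - + 1)))
          (≡.sym (+[k+r]-+r≡+k k))

  differenceAt⇒differenceAbove : ∀ k n → DifferenceAt (k ℕ.+ r) n → DifferenceAbove k n
  differenceAt⇒differenceAbove k n =
    subst (λ z → g r z (+ n) ≈P g r (z - + 1) (+ n) +P αact r (k ℕ.+ r) (g r (+ (k ℕ.+ r)) (+ n - + 1)))
          (+[k+r]-+r≡+k k)

  differenceAt-0 : ∀ t → DifferenceAt t 0
  differenceAt-0 t =
    ≈P-trans (g-0 (+ t - + r)) (≈P-sym (≈P-trans (+P-cong (g-0 ((+ t - + r) - + 1)) (linear-0 (αact-linear t))) (+P-identityʳ 1P)))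

  differenceAt-below : ∀ t n → t ℕ.< r → DifferenceAt t n
  differenceAt-below t n t<r = ≈P-trans (g-neg n eq) (≈P-sym (begin
    g r ((+ t - + r) - + 1) (+ n) +P αact r t (g r (+ t) (+ n - + 1))  ≈⟨ +P-cong (g-neg n (cong (_- + 1) eq)) (αact-below t _ t<r) ⟩
    δ₀ n +P 0P                                                          ≈⟨ +P-identityʳ (δ₀ n) ⟩
    δ₀ n                                                                ∎))
    where
      eq : + t - + r ≡ -[1+ proj₁ (+k-+r<0 t<r) ]
      eq = proj₂ (+k-+r<0 t<r)

  difference-step : ∀ k m → DifferenceAbove k m → DifferenceAt k (suc m) → DifferenceAbove k (suc m)
  difference-step k m IH-m IH-k = begin
    g r (+ k) (+ suc m)
      ≈⟨ g-rec k (suc m) ⟩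
    opK r k Gₖ +P g r (+ k - + r) (+ suc m)
      ≈⟨ +P-congˡ (opK r k Gₖ) IH-k ⟩
    opK r k Gₖ +P (G′ +P αact r k Gₖ)
      ≈⟨ x+yz≈xz+y (opK r k Gₖ) G′ (αact r k Gₖ) ⟩
    (opK r k Gₖ +P αact r k Gₖ) +P G′
      ≈⟨ +P-congʳ G′ (opK+αact k Gₖ) ⟩
    shiftOp k Gₖ +P G′
      ≈⟨ +P-congʳ G′ (≈P-trans (linear-cong (shiftOp-linear k) IH-m) (linear-+ (shiftOp-linear k) P (αₜ h))) ⟩
    (shiftOp k P +P shiftOp k (αₜ h)) +P G′
      ≈⟨ +P-congʳ G′ (+P-cong (shiftOp≈opKPred+αact k P) (shiftOp-intertwines k h (g-ext (+ t) (+ m - + 1)))) ⟩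
    ((opKPred k P +P αₜ P) +P αₜ (shiftOp t h)) +P G′
      ≈⟨ rearrange (opKPred k P) (αₜ P) (αₜ (shiftOp t h)) G′ ⟩
    (opKPred k P +P G′) +P (αₜ P +P αₜ (shiftOp t h))
      ≈⟨ +P-cong g[k-1] (linear-+ (αact-linear t) P (shiftOp t h)) ⟨
    g r (+ k - + 1) (+ suc m) +P αₜ (P +P shiftOp t h)
      ≈⟨ +P-congˡ (g r (+ k - + 1) (+ suc m)) (linear-cong (αact-linear t) g[t]) ⟨
    g r (+ k - + 1) (+ suc m) +P αₜ (g r (+ t) (+ m)) ∎
    where
      t : ℕ
      t = k ℕ.+ r
      αₜ : Op
      αₜ = αact r t
      Gₖ P h G′ : Poly r
      Gₖ = g r (+ k) (+ m)
      P = g r (+ k - + 1) (+ m)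
      h = g r (+ t) (+ m - + 1)
      G′ = g r ((+ k - + r) - + 1) (+ suc m)

      g[k-1] : g r (+ k - + 1) (+ suc m) ≈P opKPred k P +P G′
      g[k-1] = ≈P-trans (g-rec-pred k m) (+P-congˡ (opKPred k P) (reflexive (cong (λ z → g r z (+ suc m)) (swap-− (+ k) (+ 1) (+ r)))))
        where
          swap-− : ∀ (x y z : ℤ) → (x - y) - z ≡ (x - z) - y
          swap-− = solve-∀

      g[t] : g r (+ t) (+ m) ≈P P +P shiftOp t h
      g[t] = begin
        g r (+ t) (+ m)                           ≈⟨ g-rec t m ⟩
        opK r t h +P g r (+ t - + r) (+ m)        ≡⟨ cong (λ z → opK r t h +P g r z (+ m)) (+[k+r]-+r≡+k k) ⟩
        opK r t h +P Gₖ                           ≈⟨ +P-congˡ (opK r t h) IH-m ⟩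
        opK r t h +P (P +P αₜ h)                  ≈⟨ x+yz≈y+xz (opK r t h) P (αₜ h) ⟩
        P +P (opK r t h +P αₜ h)                  ≈⟨ +P-congˡ P (opK+αact t h) ⟩
        P +P shiftOp t h                          ∎

      rearrange : ∀ x y z w → ((x +P y) +P z) +P w ≈P (x +P w) +P (y +P z)
      rearrange x y z w a b = ℤ-rearrange (x a b) (y a b) (z a b) (w a b)
        where
          ℤ-rearrange : ∀ (x y z w : ℤ) → ((x + y) + z) + w ≡ (x + w) + (y + z)
          ℤ-rearrange = solve-∀

  differenceAt : ∀ n t → DifferenceAt t n
  differenceAt zero t = differenceAt-0 t
  differenceAt (suc m) = <-rec (λ t → DifferenceAt t (suc m)) step
    where
      step-+r : ∀ k → (∀ {s} → s ℕ.< k ℕ.+ r → DifferenceAt s (suc m)) → DifferenceAt (k ℕ.+ r) (suc m)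
      step-+r k rec =
        differenceAbove⇒differenceAt k (suc m)
          (difference-step k m (differenceAt⇒differenceAbove k m (differenceAt m (k ℕ.+ r)))
                               (rec (ℕₚ.m<m+n k 1≤r)))

      step : ∀ t → (∀ {s} → s ℕ.< t → DifferenceAt s (suc m)) → DifferenceAt t (suc m)
      step t rec = by-cases (t ℕ.<? r)
        where
          by-cases : Dec (t ℕ.< r) → DifferenceAt t (suc m)
          by-cases (yes t<r) = differenceAt-below t (suc m) t<r
          by-cases (no t≮r) = subst (λ t → DifferenceAt t (suc m)) t∸r+r≡t
                                    (step-+r (t ℕ.∸ r) (λ {s} s<t∸r+r → rec (subst (s ℕ.<_) t∸r+r≡t s<t∸r+r)))
            where
              t∸r+r≡t : t ℕ.∸ r ℕ.+ r ≡ t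
              t∸r+r≡t = ℕₚ.m∸n+n≡m (ℕₚ.≮⇒≥ t≮r)

  difference : ∀ k n → - (+ r) ℤ.≤ k →
    (λ a b → g r k (+ n) a b - g r (k - + 1) (+ n) a b) ≈P αact r ∣ k + + r ∣ (g r (k + + r) (+ n - + 1))
  difference k n -r≤k a b =
    ≡.trans (cong (λ z → g r z (+ n) a b - g r (z - + 1) (+ n) a b) k≡t-r)
     (≡.trans (cong (_- g r ((+ t - + r) - + 1) (+ n) a b) (differenceAt n t a b))
       (≡.trans (y+z-y≡z (g r ((+ t - + r) - + 1) (+ n) a b) (αact r t (g r (+ t) (+ n - + 1)) a b))
         (cong (λ z → αact r t (g r z (+ n - + 1)) a b) (≡.sym k+r≡t))))
    where
      t : ℕ
      t = ∣ k + + r ∣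

      k+r≡t : k + + r ≡ + t
      k+r≡t = ≡.sym (ℤₚ.0≤i⇒+∣i∣≡i (subst (ℤ._≤ k + + r) (ℤₚ.+-inverseˡ (+ r)) (ℤₚ.+-monoˡ-≤ (+ r) -r≤k)))

      k≡t-r : k ≡ + t - + r
      k≡t-r = ≡.trans (x≡x+y-y k (+ r)) (cong (_- + r) k+r≡t)
        where
          x≡x+y-y : ∀ (x y : ℤ) → x ≡ (x + y) - y
          x≡x+y-y = solve-∀

      y+z-y≡z : ∀ (y z : ℤ) → (y + z) - y ≡ z
      y+z-y≡z = solve-∀

  sumα-0 : ∀ X → sumα r 0 X ≈P mulY X
  sumα-0 X = +P-cancelʳ (αact r 0 X) (sumα r 0 X) (mulY X) (begin
    sumα r 0 X +P αact r 0 X                      ≈⟨ sumα+αact 0 X ⟩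
    αWindow 0 X                                   ≈⟨ sumUpTo-suc r (λ i → αact r i X) ⟩
    sumUpTo r (λ i → αact r i X) +P αact r r X    ≈⟨ +P-cong (sumUpTo-0 r _ (λ i i<r → αact-below i X i<r)) (αact-r X) ⟩
    0P +P mulY X                                  ≈⟨ +P-comm 0P (mulY X) ⟩
    mulY X +P 0P                                  ≈⟨ +P-congˡ (mulY X) (αact-below 0 X 1≤r) ⟨
    mulY X +P αact r 0 X                          ∎)

  g-0-DyPow : ∀ n → g r (+ 0) (+ n) ≈P DyPow r n
  g-0-DyPow zero = g-0 (+ 0)
  g-0-DyPow (suc m) = begin
    g r (+ 0) (+ suc m)                                         ≈⟨ g-rec 0 (suc m) ⟩
    opK r 0 G +P g r (+ 0 - + r) (+ suc m)                      ≈⟨ +P-congˡ (opK r 0 G) (g-neg (suc m) (proj₂ (+k-+r<0 1≤r))) ⟩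
    opK r 0 G +P 0P                                             ≈⟨ +P-identityʳ (opK r 0 G) ⟩
    Dtilde r G +P sumα r 0 G                                    ≈⟨ +P-congˡ (Dtilde r G) (sumα-0 G) ⟩
    Dtilde r G +P mulY G                                        ≈⟨ +P-cong (linear-cong Dtilde-linear (g-0-DyPow m)) (linear-cong mulY-linear (g-0-DyPow m)) ⟩
    Dtilde r (DyPow r m) +P mulY (DyPow r m)                    ∎
    where
      G : Poly r
      G = g r (+ 0) (+ m)

  when : Bool → Poly r → Poly r
  when c X = if c then X else 0P

  when-linear : ∀ c {L} → Linear L → Linear (λ p → when c (L p))
  when-linear true lL = lL
  when-linear false lL = 0-linear

  -- Weighted sum over the paths with L steps from height h to height k.
  pathSum : ℕ → ℕ → ℕ → Poly r
  pathSum h k zero = if h ℕ.≡ᵇ k then 1P else 0P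
  pathSum h k (suc L) = pathSum (suc h) k L +P when (r ℕ.≤ᵇ h) (αact r h (pathSum (h ℕ.∸ r) k L))

  pathSum-ext : ∀ L h k → Extensional (pathSum h k L)
  pathSum-ext zero h k with h ℕ.≡ᵇ k
  ... | true = 1P-ext
  ... | false = 0P-ext
  pathSum-ext (suc L) h k e b =
    cong₂ _+_ (pathSum-ext L (suc h) k e b)
              (linear-ext (when-linear (r ℕ.≤ᵇ h) (αact-linear h)) _ (pathSum-ext L (h ℕ.∸ r) k) e b)

  sumList-++ : ∀ xs ys → sumList (xs ++ ys) ≈P sumList xs +P sumList ys
  sumList-++ [] ys = ≈P-sym (+P-identityˡ (sumList ys))
  sumList-++ (x ∷ xs) ys = ≈P-trans (+P-congˡ x (sumList-++ xs ys)) (≈P-sym (+P-assoc x (sumList xs) (sumList ys)))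

  linear-sumList : ∀ {L} → Linear L → ∀ xs → L (sumList xs) ≈P sumList (map L xs)
  linear-sumList lL [] = linear-0 lL
  linear-sumList {L} lL (x ∷ xs) = ≈P-trans (linear-+ lL x (sumList xs)) (+P-congˡ (L x) (linear-sumList lL xs))

  sumList-pathWeight : ∀ L h → sumList (map (pathWeight r (αact r) h) (allSeqs L)) ≈P pathSum h 0 L
  sumList-pathWeight zero h = +P-identityʳ (pathSum h 0 0)
  sumList-pathWeight (suc L) h = begin
    sumList (map w (map (rise ∷_) S ++ map (fall ∷_) S))
      ≡⟨ cong sumList (≡.trans (map-++ w (map (rise ∷_) S) (map (fall ∷_) S))
                               (cong₂ _++_ (≡.sym (map-∘ S)) (≡.sym (map-∘ S)))) ⟩
    sumList (map (λ s → w (rise ∷ s)) S ++ map (λ s → w (fall ∷ s)) S)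
      ≈⟨ sumList-++ (map (λ s → w (rise ∷ s)) S) (map (λ s → w (fall ∷ s)) S) ⟩
    sumList (map (pathWeight r (αact r) (suc h)) S) +P sumList (map (λ s → w (fall ∷ s)) S)
      ≈⟨ +P-cong (sumList-pathWeight L (suc h)) falls ⟩
    pathSum h 0 (suc L) ∎
    where
      w : List Step → Poly r
      w = pathWeight r (αact r) h
      S : List (List Step)
      S = allSeqs L
      falls : sumList (map (λ s → w (fall ∷ s)) S) ≈P when (r ℕ.≤ᵇ h) (αact r h (pathSum (h ℕ.∸ r) 0 L))
      falls = begin
        sumList (map (λ s → w (fall ∷ s)) S)                            ≡⟨ cong sumList (map-∘ S) ⟩
        sumList (map (λ p → when (r ℕ.≤ᵇ h) (αact r h p)) (map (pathWeight r (αact r) (h ℕ.∸ r)) S))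
          ≈⟨ linear-sumList (when-linear (r ℕ.≤ᵇ h) (αact-linear h)) (map (pathWeight r (αact r) (h ℕ.∸ r)) S) ⟨
        when (r ℕ.≤ᵇ h) (αact r h (sumList (map (pathWeight r (αact r) (h ℕ.∸ r)) S)))
          ≈⟨ linear-cong (when-linear (r ℕ.≤ᵇ h) (αact-linear h)) (sumList-pathWeight L (h ℕ.∸ r)) ⟩
        when (r ℕ.≤ᵇ h) (αact r h (pathSum (h ℕ.∸ r) 0 L))              ∎

  pathSumPred : ℕ → ℕ → ℕ → Poly r
  pathSumPred zero h L = 0P
  pathSumPred (suc k) h L = pathSum h k L

  pathSumPred-suc : ∀ k h L →
    pathSumPred k h (suc L) ≈P pathSumPred k (suc h) L +P when (r ℕ.≤ᵇ h) (αact r h (pathSumPred k (h ℕ.∸ r) L))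
  pathSumPred-suc zero h L =
    ≈P-sym (≈P-trans (+P-congˡ 0P (linear-0 (when-linear (r ℕ.≤ᵇ h) (αact-linear h)))) (+P-identityˡ 0P))
  pathSumPred-suc (suc k) h L = ≈P-refl

  pathSum-last-step : ∀ h k → when (r ℕ.≤ᵇ h) (αact r h (pathSum (h ℕ.∸ r) k 0)) ≈P αact r (k ℕ.+ r) (pathSum h (k ℕ.+ r) 0)
  pathSum-last-step h k with r ℕ.≤ᵇ h in r≤h | (h ℕ.∸ r) ℕ.≡ᵇ k in h∸r≡k | h ℕ.≡ᵇ (k ℕ.+ r) in h≡k+r
  ... | true | true | true = reflexive (cong (λ t → αact r t 1P) (ℕₚ.≡ᵇ⇒≡ h (k ℕ.+ r) (true⇒T h≡k+r)))
  ... | true | true | false = ⊥-elim (subst T h≡k+r (ℕₚ.≡⇒≡ᵇ h (k ℕ.+ r)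
          (≡.trans (≡.sym (ℕₚ.m∸n+n≡m (ℕₚ.≤ᵇ⇒≤ r h (true⇒T r≤h)))) (cong (ℕ._+ r) (ℕₚ.≡ᵇ⇒≡ _ k (true⇒T h∸r≡k))))))
  ... | true | false | true = ⊥-elim (subst T h∸r≡k (ℕₚ.≡⇒≡ᵇ (h ℕ.∸ r) k
          (≡.trans (cong (ℕ._∸ r) (ℕₚ.≡ᵇ⇒≡ h (k ℕ.+ r) (true⇒T h≡k+r))) (ℕₚ.m+n∸n≡m k r))))
  ... | true | false | false = ≈P-trans (linear-0 (αact-linear h)) (≈P-sym (linear-0 (αact-linear (k ℕ.+ r))))
  ... | false | _ | true = ⊥-elim (subst T r≤h (ℕₚ.≤⇒≤ᵇ
          (subst (r ℕ.≤_) (≡.sym (ℕₚ.≡ᵇ⇒≡ h (k ℕ.+ r) (true⇒T h≡k+r))) (ℕₚ.m≤n+m r k))))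
  ... | false | _ | false = ≈P-sym (linear-0 (αact-linear (k ℕ.+ r)))

  pathSum-last : ∀ L h k → pathSum h k (suc L) ≈P pathSumPred k h L +P αact r (k ℕ.+ r) (pathSum h (k ℕ.+ r) L)
  pathSum-last zero h zero = +P-congˡ 0P (pathSum-last-step h zero)
  pathSum-last zero h (suc k) = +P-congˡ (pathSum h k 0) (pathSum-last-step h (suc k))
  pathSum-last (suc L) h k = begin
    pathSum (suc h) k (suc L) +P when c (αₕ (pathSum (h ℕ.∸ r) k (suc L)))
      ≈⟨ +P-cong (pathSum-last L (suc h) k) (linear-cong (when-linear c (αact-linear h)) (pathSum-last L (h ℕ.∸ r) k)) ⟩
    (pathSumPred k (suc h) L +P αₜ (pathSum (suc h) t L)) +P when c (αₕ (pathSumPred k (h ℕ.∸ r) L +P αₜ (pathSum (h ℕ.∸ r) t L)))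
      ≈⟨ regroup c (pathSumPred k (suc h) L) (pathSum (suc h) t L) (pathSumPred k (h ℕ.∸ r) L) (pathSum (h ℕ.∸ r) t L)
                 (pathSum-ext L (h ℕ.∸ r) t) ⟩
    (pathSumPred k (suc h) L +P when c (αₕ (pathSumPred k (h ℕ.∸ r) L))) +P αₜ (pathSum (suc h) t L +P when c (αₕ (pathSum (h ℕ.∸ r) t L)))
      ≈⟨ +P-congʳ (αₜ (pathSum h t (suc L))) (pathSumPred-suc k h L) ⟨
    pathSumPred k h (suc L) +P αₜ (pathSum h t (suc L)) ∎
    where
      c : Bool
      c = r ℕ.≤ᵇ h
      t : ℕ
      t = k ℕ.+ r
      αₕ αₜ : Op
      αₕ = αact r h
      αₜ = αact r t

      regroup : ∀ c p₁ w₁ p₂ w₂ → Extensional w₂ →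
        (p₁ +P αₜ w₁) +P when c (αₕ (p₂ +P αₜ w₂)) ≈P (p₁ +P when c (αₕ p₂)) +P αₜ (w₁ +P when c (αₕ w₂))
      regroup false p₁ w₁ p₂ w₂ _ =
        ≈P-trans (+P-identityʳ (p₁ +P αₜ w₁))
                 (+P-cong (≈P-sym (+P-identityʳ p₁)) (linear-cong (αact-linear t) (≈P-sym (+P-identityʳ w₁))))
      regroup true p₁ w₁ p₂ w₂ E = begin
        (p₁ +P αₜ w₁) +P αₕ (p₂ +P αₜ w₂)             ≈⟨ +P-congˡ (p₁ +P αₜ w₁) (linear-+ (αact-linear h) p₂ (αₜ w₂)) ⟩
        (p₁ +P αₜ w₁) +P (αₕ p₂ +P αₕ (αₜ w₂))        ≈⟨ +P-congˡ (p₁ +P αₜ w₁) (+P-congˡ (αₕ p₂) (αact-comm h t w₂ E)) ⟩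
        (p₁ +P αₜ w₁) +P (αₕ p₂ +P αₜ (αₕ w₂))        ≈⟨ +P-interchange p₁ (αₜ w₁) (αₕ p₂) (αₜ (αₕ w₂)) ⟩
        (p₁ +P αₕ p₂) +P (αₜ w₁ +P αₜ (αₕ w₂))        ≈⟨ +P-congˡ (p₁ +P αₕ p₂) (linear-+ (αact-linear t) w₁ (αₕ w₂)) ⟨
        (p₁ +P αₕ p₂) +P αₜ (w₁ +P αₕ w₂)             ∎

  pathSum-unreachable : ∀ L h k → h ℕ.+ L ℕ.< k → pathSum h k L ≈P 0P
  pathSum-unreachable zero h k h+0<k with h ℕ.≡ᵇ k in h≡k
  ... | true = ⊥-elim (ℕₚ.<-irrefl (ℕₚ.≡ᵇ⇒≡ h k (true⇒T h≡k)) (subst (ℕ._< k) (ℕₚ.+-identityʳ h) h+0<k))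
  ... | false = ≈P-refl
  pathSum-unreachable (suc L) h k h+1+L<k =
    ≈P-trans (+P-cong (pathSum-unreachable L (suc h) k h+1+L<k′)
                      (≈P-trans (linear-cong (when-linear (r ℕ.≤ᵇ h) (αact-linear h)) (pathSum-unreachable L (h ℕ.∸ r) k h∸r+L<k))
                                (linear-0 (when-linear (r ℕ.≤ᵇ h) (αact-linear h)))))
             (+P-identityˡ 0P)
    where
      h+1+L<k′ : suc h ℕ.+ L ℕ.< k
      h+1+L<k′ = subst (ℕ._< k) (ℕₚ.+-suc h L) h+1+L<k
      h∸r+L<k : (h ℕ.∸ r) ℕ.+ L ℕ.< k
      h∸r+L<k = ℕₚ.≤-<-trans (ℕₚ.+-monoˡ-≤ L (ℕₚ.m∸n≤m h r)) (ℕₚ.<-trans (ℕₚ.n<1+n (h ℕ.+ L)) h+1+L<k′)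

  differenceAbove : ∀ k n → DifferenceAbove k n
  differenceAbove k n = differenceAt⇒differenceAbove k n (differenceAt n (k ℕ.+ r))

  private
    length-0 : ∀ r k → suc r ℕ.* 0 ℕ.+ k ≡ k
    length-0 = ℕSolver.solve-∀
    length-suc : ∀ r m → suc r ℕ.* suc m ℕ.+ 0 ≡ suc (suc r ℕ.* m ℕ.+ r)
    length-suc = ℕSolver.solve-∀
    length-shift : ∀ r m k → suc r ℕ.* m ℕ.+ (suc k ℕ.+ r) ≡ suc r ℕ.* suc m ℕ.+ k
    length-shift = ℕSolver.solve-∀

  g≈pathSum : ∀ n k → g r (+ k) (+ n) ≈P pathSum 0 k (suc r ℕ.* n ℕ.+ k)
  g≈pathSum zero zero = ≈P-trans (g-0 (+ 0)) (reflexive (cong (pathSum 0 0) (≡.sym (length-0 r 0))))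
  g≈pathSum (suc m) zero = begin
    g r (+ 0) (+ suc m)                                 ≈⟨ differenceAbove 0 (suc m) ⟩
    0P +P αact r r (g r (+ r) (+ m))                    ≈⟨ +P-identityˡ _ ⟩
    αact r r (g r (+ r) (+ m))                          ≈⟨ linear-cong (αact-linear r) (g≈pathSum m r) ⟩
    αact r r (pathSum 0 r (suc r ℕ.* m ℕ.+ r))          ≈⟨ +P-identityˡ _ ⟨
    0P +P αact r r (pathSum 0 r (suc r ℕ.* m ℕ.+ r))    ≈⟨ pathSum-last (suc r ℕ.* m ℕ.+ r) 0 0 ⟨
    pathSum 0 0 (suc (suc r ℕ.* m ℕ.+ r))               ≡⟨ cong (pathSum 0 0) (≡.sym (length-suc r m)) ⟩
    pathSum 0 0 (suc r ℕ.* suc m ℕ.+ 0)                 ∎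
  g≈pathSum n (suc k) = begin
    g r (+ suc k) (+ n)
      ≈⟨ differenceAbove (suc k) n ⟩
    g r (+ k) (+ n) +P αact r t (g r (+ t) (+ n - + 1))
      ≈⟨ +P-cong (g≈pathSum n k) (linear-cong (αact-linear t) (g[t,n-1] n)) ⟩
    pathSum 0 k (suc r ℕ.* n ℕ.+ k) +P αact r t (pathSum 0 t (suc r ℕ.* n ℕ.+ k))
      ≈⟨ pathSum-last (suc r ℕ.* n ℕ.+ k) 0 (suc k) ⟨
    pathSum 0 (suc k) (suc (suc r ℕ.* n ℕ.+ k))
      ≡⟨ cong (pathSum 0 (suc k)) (≡.sym (ℕₚ.+-suc (suc r ℕ.* n) k)) ⟩
    pathSum 0 (suc k) (suc r ℕ.* n ℕ.+ suc k) ∎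
    where
      t : ℕ
      t = suc k ℕ.+ r
      g[t,n-1] : ∀ n → g r (+ t) (+ n - + 1) ≈P pathSum 0 t (suc r ℕ.* n ℕ.+ k)
      g[t,n-1] zero = ≈P-sym (pathSum-unreachable _ 0 t (subst (ℕ._< t) (≡.sym (length-0 r k)) k<t))
        where
          k<t : k ℕ.< t
          k<t = ℕₚ.≤-trans (ℕₚ.n<1+n k) (ℕₚ.m≤m+n (suc k) r)
      g[t,n-1] (suc m) = ≈P-trans (g≈pathSum m t) (reflexive (cong (pathSum 0 t) (length-shift r m k)))

  StieltjesRogers≈g : ∀ n → StieltjesRogers r (αact r) n ≈P g r (+ 0) (+ n)
  StieltjesRogers≈g n = begin
    StieltjesRogers r (αact r) n                 ≈⟨ sumList-pathWeight (suc r ℕ.* n) 0 ⟩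
    pathSum 0 0 (suc r ℕ.* n)                    ≡⟨ cong (pathSum 0 0) (≡.sym (ℕₚ.+-identityʳ (suc r ℕ.* n))) ⟩
    pathSum 0 0 (suc r ℕ.* n ℕ.+ 0)              ≈⟨ g≈pathSum n 0 ⟨
    g r (+ 0) (+ n)                              ∎

proposition5p1 : (r : ℕ) → 1 ≤ r →
    ((k : ℤ) → g r k (+ 0) ≈P 1P)
    × ((k : ℤ) → (n : ℕ) → (- (+ r)) Data.Integer.≤ k →
         (λ a b → g r k (+ n) a b - g r (k - + 1) (+ n) a b)
           ≈P αact r ∣ k + + r ∣ (g r (k + + r) (+ n - + 1)))
    × ((n : ℕ) → (StieltjesRogers r (αact r) n ≈P g r (+ 0) (+ n))
         × (g r (+ 0) (+ n) ≈P DyPow r n))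
proposition5p1 r 1≤r = g-0 , difference , λ n → StieltjesRogers≈g n , g-0-DyPow n
  where open Recurrence r 1≤r
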